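{- Let $d\geq 1$ be an integer and equip $\mathbb{Z}^d$ with the lexicographic order $<$. Let $t_0<t_1<t_2<\cdots$ be elements of $\mathbb{Z}^d$ such that $t_0>0$, $t_n\geq 2t_{n-1}$ for all $n\geq 1$, and for some $n\geq 0$ all coordinates of $t_n$ are positive. Put $\mathcal{T}=\{t_0,t_1,t_2,\dots\}$, $\mathcal{V}=\mathcal{T}\cup(-\mathcal{T})$, $\mathcal{W}=\mathcal{T}\cup\{0\}\cup(-\mathcal{T})$. Then: (1) If $t_n>3t_{n-1}$ for all $n\geq1$, then $\mathcal{W}$ and some symmetric subset $\mathcal{E}$ of $\mathbb{Z}^d$ containing the origin form a co-minimal pair in $\mathbb{Z}^d$. (2) If $t_n>3t_{n-1}$ for all $n\geq1$, then $\mathcal{W}$ and some symmetric subset $\mathcal{F}$ of $\mathbb{Z}^d$ not containing the origin form a co-minimal pair in $\mathbb{Z}^d$. (3) If $t_n\geq 6t_{n-1}$ for all $n\geq1$, then $\mathcal{W}$ and some subset $\mathcal{G}$ of $\mathbb{Z}^d\setminus\mathbb{Z}^d_{\geq 0}$ form a co-minimal pair in $\mathbb{Z}^d$. (4) If $t_n>3t_{n-1}$ for all $n\geq1$, then $\mathcal{V}$ and some symmetric subset $\mathcal{P}$ of $\mathbb{Z}^d$ containing the origin form a co-minimal pair in $\mathbb{Z}^d$. (5) If $t_n>3t_{n-1}$ for all $n\geq1$, then $\mathcal{V}$ and some symmetric subset $\mathcal{Q}$ of $\mathbb{Z}^d$ not containing the origin form a co-minimal pair in $\mathbb{Z}^d$.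 (6) If $t_n\geq 6t_{n-1}$ for all $n\geq1$, then $\mathcal{V}$ and some subset $\mathcal{R}$ of $\mathbb{Z}^d\setminus\mathbb{Z}^d_{\geq 0}$ form a co-minimal pair in $\mathbb{Z}^d$. (7) If $t_n\geq 2t_{n-1}$ for all $n\geq1$, then $\mathcal{T}$ is a minimal complement to some subset of $\mathbb{Z}^d\setminus\mathbb{Z}^d_{\geq0}$. In addition, if there is a coordinate index $i$ such that the $i$-th coordinate of $t_n-2t_{n-1}$ tends to $+\infty$ as $n\to\infty$, then $\mathcal{T}$ and some subset $\mathcal{S}$ of $\mathbb{Z}^d\setminus\mathbb{Z}^d_{\geq0}$ form a co-minimal pair in $\mathbb{Z}^d$.
   Context: All inequalities between elements of $\mathbb{Z}^d$ (such as $t_n\geq 2t_{n-1}$, $t_n>3t_{n-1}$, $t_0>0$) refer to the lexicographic order on $\mathbb{Z}^d$; $kt$ denotes the scalar multiple of $t\in\mathbb{Z}^d$. For $x\in\mathbb{Z}^d$, $\mathbb{Z}^d_{\geq x}=\{n\in\mathbb{Z}^d: n\geq x\}$ (lexicographically). A set $X$ is symmetric if $X=-X$. For an abelian group $G$ and nonempty $W\subseteq G$, a nonempty $W'\subseteq G$ is a minimal complement to $W$ if $W+W'=G$ and $W+(W'\setminus\{w'\})\neq G$ for every $w'\in W'$. Nonempty subsets $A,B\subseteq G$ form a co-minimal pair if $A+B=G$, $A'+B\neq G$ for every nonempty proper subset $A'\subsetneq A$, and $A+B'\neq G$ for every nonempty proper subset $B'\subsetneq B$. -}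

module Defs where

open import Level using (0ℓ)
open import Data.Nat using (ℕ; zero; suc; _≥_)
open import Data.Integer as ℤ using (ℤ; +_)
open import Data.Fin using (Fin)
open import Data.Vec using (Vec; []; _∷_; map; replicate; zipWith; lookup)
open import Data.Product using (Σ; ∃; _×_; _,_)
open import Data.Sum using (_⊎_)
open import Data.Empty using (⊥)
open import Relation.Nullary using (¬_)
open import Relation.Unary using (Pred; _⊆_)
open import Relation.Binary.PropositionalEquality using (_≡_; _≢_)

Zd : ℕ → Set
Zd d = Vec ℤ d

0v : ∀ {d} → Zd d
0v = replicate _ (+ 0)

_⊕_ : ∀ {d} → Zd d → Zd d → Zd d
_⊕_ = zipWith ℤ._+_

⊖_ : ∀ {d} → Zd d → Zd d
⊖_ = map (λ z → ℤ.- z)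

_·_ : ∀ {d} → ℤ → Zd d → Zd d
k · t = map (k ℤ.*_) t

_<ₗ_ : ∀ {d} → Zd d → Zd d → Set
[] <ₗ [] = ⊥
(x ∷ xs) <ₗ (y ∷ ys) = (x ℤ.< y) ⊎ (x ≡ y × xs <ₗ ys)

_≤ₗ_ : ∀ {d} → Zd d → Zd d → Set
x ≤ₗ y = x <ₗ y ⊎ x ≡ y

Subset : ℕ → Set₁
Subset d = Pred (Zd d) 0ℓ

Nonempty : ∀ {d} → Subset d → Set
Nonempty A = ∃ λ x → A x

Symmetric : ∀ {d} → Subset d → Set
Symmetric A = ∀ x → (A x → A (⊖ x)) × (A (⊖ x) → A x)

Covers : ∀ {d} → Subset d → Subset d → Set
Covers A B = ∀ g → ∃ λ a → ∃ λ b → A a × B b × (a ⊕ b) ≡ g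

NonemptyProperSubset : ∀ {d} → Subset d → Subset d → Set
NonemptyProperSubset A' A = A' ⊆ A × Nonempty A' × (∃ λ x → A x × ¬ A' x)

MinimalComplement : ∀ {d} → Subset d → Subset d → Set
MinimalComplement W' W =
  Nonempty W' × Covers W W' ×
  (∀ w' → W' w' → ¬ Covers W (λ x → W' x × x ≢ w'))

CoMinimalPair : ∀ {d} → Subset d → Subset d → Set₁
CoMinimalPair A B =
  Nonempty A × Nonempty B × Covers A B ×
  (∀ (A' : Subset _) → NonemptyProperSubset A' A → ¬ Covers A' B) ×
  (∀ (B' : Subset _) → NonemptyProperSubset B' B → ¬ Covers A B')

TSet : ∀ {d} → (ℕ → Zd d) → Subset d
TSet t x = ∃ λ n → t n ≡ x

VSet : ∀ {d} → (ℕ → Zd d) → Subset d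
VSet t x = TSet t x ⊎ TSet t (⊖ x)

WSet : ∀ {d} → (ℕ → Zd d) → Subset d
WSet t x = TSet t x ⊎ x ≡ 0v ⊎ TSet t (⊖ x)

OutsideNonneg : ∀ {d} → Subset d → Set
OutsideNonneg G = ∀ x → G x → ¬ (0v ≤ₗ x)

CoordGapToInfinity : ∀ {d} → (ℕ → Zd d) → Fin d → Set
CoordGapToInfinity t i =
  ∀ (M : ℤ) → ∃ λ N → ∀ n → n ≥ N →
    M ℤ.< lookup (t (suc n) ⊕ (⊖ ((+ 2) · t n))) i

module Submission where

-- All complements are built greedily along an enumeration of ℤ^d: a point g that is not
-- yet covered is covered by adding b = g - t_K (in the symmetric constructions also -b),
-- with K so large that t_K dominates every quantity in sight.  Lacunarity then makes
-- sums b + a (a ∈ W) essentially unique: if |c| < t_m, the only ways to write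
-- c = t_{m+1} + a' - a with a, a' ∈ W are the trivial cancellations a = t_{m+1} or
-- a' = -t_{m+1}.  Every other sign and index pattern is a finite system of linear
-- inequalities between the t_i that contradicts t_{n+1} > 3t_n, and is refuted by an
-- explicit nonnegative combination.  Unique representation gives co-minimality at once:
-- dropping b uncovers b + a for a suitable a ∈ W, and dropping a uncovers a + b.  In the
-- symmetric case b and -b collide only when 2g = 3t_K - t_{K+1}, which cannot hold for g
-- and -g simultaneously; for T alone, where only t_{n+1} ≥ 2t_n is available, the extra
-- collision c = 2t_{K} - t_{K+1} is excluded eventually by the growth of one coordinate of
-- t_{n+1} - 2t_n.  The minimal complement in (7) is explicit: the negative vectors that
-- are not of the form -(t_a + t_c) with a ≠ c.

open import Defs
open import Data.Nat using (ℕ; suc; _≥_)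
open import Data.Integer using (ℤ; +_; _<_)
open import Data.Fin using (Fin)
open import Data.Vec using (lookup)
open import Data.Product using (Σ; ∃; _×_)
open import Relation.Nullary using (¬_)

open import Relation.Nullary using (Dec; yes; no)
open import Relation.Nullary.Decidable using (_⊎-dec_)

open import Data.Nat as ℕ using (zero; _+_)
import Data.Nat.Properties as ℕP
open import Data.Integer as ℤ using (-[1+_]; +[1+_])
import Data.Integer.Properties as ℤP
open import Data.Integer.Solver using (module +-*-Solver)
open import Data.Fin using (#_; toℕ; fromℕ<)
import Data.Fin.Properties as FinP
open import Data.Vec using (Vec; []; _∷_)
open import Data.Vec.Properties using (∷-injectiveˡ; ∷-injectiveʳ; ≡-dec)
open import Data.List using (List; []; _∷_; _++_)
open import Data.List.Relation.Unary.Any using (Any; any?; here; there)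
open import Data.List.Membership.Propositional using (_∈_; find; lose)
open import Data.List.Membership.Propositional.Properties using (∈-++⁺ʳ)
open import Data.Product using (_,_; proj₁; proj₂)
open import Data.Sum using (_⊎_; inj₁; inj₂; [_,_]′)
open import Data.Empty using (⊥; ⊥-elim)
open import Relation.Binary using (tri<; tri≈; tri>)
open import Relation.Binary.PropositionalEquality
open import Function using (case_of_; _∘_)


⊕-assoc : ∀ {d} (x y z : Zd d) → (x ⊕ y) ⊕ z ≡ x ⊕ (y ⊕ z)
⊕-assoc [] [] [] = refl
⊕-assoc (a ∷ x) (b ∷ y) (c ∷ z) = cong₂ _∷_ (ℤP.+-assoc a b c) (⊕-assoc x y z)

⊕-comm : ∀ {d} (x y : Zd d) → x ⊕ y ≡ y ⊕ x
⊕-comm [] [] = refl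
⊕-comm (a ∷ x) (b ∷ y) = cong₂ _∷_ (ℤP.+-comm a b) (⊕-comm x y)

⊕-identityˡ : ∀ {d} (x : Zd d) → 0v ⊕ x ≡ x
⊕-identityˡ [] = refl
⊕-identityˡ (a ∷ x) = cong₂ _∷_ (ℤP.+-identityˡ a) (⊕-identityˡ x)

⊕-identityʳ : ∀ {d} (x : Zd d) → x ⊕ 0v ≡ x
⊕-identityʳ x = trans (⊕-comm x 0v) (⊕-identityˡ x)

⊕-inverseʳ : ∀ {d} (x : Zd d) → x ⊕ (⊖ x) ≡ 0v
⊕-inverseʳ [] = refl
⊕-inverseʳ (a ∷ x) = cong₂ _∷_ (ℤP.+-inverseʳ a) (⊕-inverseʳ x)

⊕-inverseˡ : ∀ {d} (x : Zd d) → (⊖ x) ⊕ x ≡ 0v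
⊕-inverseˡ x = trans (⊕-comm (⊖ x) x) (⊕-inverseʳ x)

⊖-involutive : ∀ {d} (x : Zd d) → ⊖ (⊖ x) ≡ x
⊖-involutive [] = refl
⊖-involutive (a ∷ x) = cong₂ _∷_ (ℤP.neg-involutive a) (⊖-involutive x)

⊖-distrib-⊕ : ∀ {d} (x y : Zd d) → ⊖ (x ⊕ y) ≡ (⊖ x) ⊕ (⊖ y)
⊖-distrib-⊕ [] [] = refl
⊖-distrib-⊕ (a ∷ x) (b ∷ y) = cong₂ _∷_ (ℤP.neg-distrib-+ a b) (⊖-distrib-⊕ x y)

⊖-0v : ∀ {d} → ⊖ (0v {d}) ≡ 0v
⊖-0v {zero} = refl
⊖-0v {suc d} = cong (+ 0 ∷_) ⊖-0v

⊕-cancelˡ : ∀ {d} (x y z : Zd d) → x ⊕ y ≡ x ⊕ z → y ≡ z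
⊕-cancelˡ x y z e = begin
  y                 ≡⟨ sym (⊕-identityˡ y) ⟩
  0v ⊕ y            ≡⟨ cong (_⊕ y) (sym (⊕-inverseˡ x)) ⟩
  ((⊖ x) ⊕ x) ⊕ y   ≡⟨ ⊕-assoc (⊖ x) x y ⟩
  (⊖ x) ⊕ (x ⊕ y)   ≡⟨ cong ((⊖ x) ⊕_) e ⟩
  (⊖ x) ⊕ (x ⊕ z)   ≡⟨ sym (⊕-assoc (⊖ x) x z) ⟩
  ((⊖ x) ⊕ x) ⊕ z   ≡⟨ cong (_⊕ z) (⊕-inverseˡ x) ⟩
  0v ⊕ z            ≡⟨ ⊕-identityˡ z ⟩
  z                 ∎
  where open ≡-Reasoning

⊕-cancelʳ : ∀ {d} (x y z : Zd d) → y ⊕ x ≡ z ⊕ x → y ≡ z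
⊕-cancelʳ x y z e = ⊕-cancelˡ x y z (trans (⊕-comm x y) (trans e (⊕-comm z x)))

x⊖y⊕y≡x : ∀ {d} (x y : Zd d) → (x ⊕ (⊖ y)) ⊕ y ≡ x
x⊖y⊕y≡x x y = trans (⊕-assoc x (⊖ y) y) (trans (cong (x ⊕_) (⊕-inverseˡ y)) (⊕-identityʳ x))

x⊖y≡0⇒x≡y : ∀ {d} (x y : Zd d) → x ⊕ (⊖ y) ≡ 0v → x ≡ y
x⊖y≡0⇒x≡y x y e = trans (sym (x⊖y⊕y≡x x y)) (trans (cong (_⊕ y) e) (⊕-identityˡ y))

⊖-equation : ∀ {d} (b a y a' : Zd d) → (⊖ b) ⊕ a ≡ y ⊕ a' → b ⊕ (⊖ a) ≡ (⊖ y) ⊕ (⊖ a')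
⊖-equation b a y a' e = begin
  b ⊕ (⊖ a)             ≡⟨ sym (⊖-involutive (b ⊕ (⊖ a))) ⟩
  ⊖ (⊖ (b ⊕ (⊖ a)))     ≡⟨ cong ⊖_ (⊖-distrib-⊕ b (⊖ a)) ⟩
  ⊖ ((⊖ b) ⊕ (⊖ (⊖ a))) ≡⟨ cong (λ w → ⊖ ((⊖ b) ⊕ w)) (⊖-involutive a) ⟩
  ⊖ ((⊖ b) ⊕ a)         ≡⟨ cong ⊖_ e ⟩
  ⊖ (y ⊕ a')            ≡⟨ ⊖-distrib-⊕ y a' ⟩
  (⊖ y) ⊕ (⊖ a')        ∎
  where open ≡-Reasoning

⊕-interchange : ∀ {d} (a b c e : Zd d) → (a ⊕ b) ⊕ (c ⊕ e) ≡ (a ⊕ c) ⊕ (b ⊕ e)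
⊕-interchange a b c e = begin
  (a ⊕ b) ⊕ (c ⊕ e) ≡⟨ ⊕-assoc a b (c ⊕ e) ⟩
  a ⊕ (b ⊕ (c ⊕ e)) ≡⟨ cong (a ⊕_) (sym (⊕-assoc b c e)) ⟩
  a ⊕ ((b ⊕ c) ⊕ e) ≡⟨ cong (λ w → a ⊕ (w ⊕ e)) (⊕-comm b c) ⟩
  a ⊕ ((c ⊕ b) ⊕ e) ≡⟨ cong (a ⊕_) (⊕-assoc c b e) ⟩
  a ⊕ (c ⊕ (b ⊕ e)) ≡⟨ sym (⊕-assoc a c (b ⊕ e)) ⟩
  (a ⊕ c) ⊕ (b ⊕ e) ∎
  where open ≡-Reasoning

·-distribʳ-+ : ∀ {d} (a b : ℤ) (x : Zd d) → (a ℤ.+ b) · x ≡ (a · x) ⊕ (b · x)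
·-distribʳ-+ a b [] = refl
·-distribʳ-+ a b (c ∷ x) = cong₂ _∷_ (ℤP.*-distribʳ-+ c a b) (·-distribʳ-+ a b x)

·-distribˡ-⊕ : ∀ {d} (a : ℤ) (x y : Zd d) → a · (x ⊕ y) ≡ (a · x) ⊕ (a · y)
·-distribˡ-⊕ a [] [] = refl
·-distribˡ-⊕ a (b ∷ x) (c ∷ y) = cong₂ _∷_ (ℤP.*-distribˡ-+ a b c) (·-distribˡ-⊕ a x y)

·-assoc : ∀ {d} (a b : ℤ) (x : Zd d) → (a ℤ.* b) · x ≡ a · (b · x)
·-assoc a b [] = refl
·-assoc a b (c ∷ x) = cong₂ _∷_ (ℤP.*-assoc a b c) (·-assoc a b x)

·-zeroˡ : ∀ {d} (x : Zd d) → (+ 0) · x ≡ 0v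
·-zeroˡ [] = refl
·-zeroˡ (a ∷ x) = cong (+ 0 ∷_) (·-zeroˡ x)

·-zeroʳ : ∀ {d} (a : ℤ) → a · (0v {d}) ≡ 0v
·-zeroʳ {zero} a = refl
·-zeroʳ {suc d} a = cong₂ _∷_ (ℤP.*-zeroʳ a) (·-zeroʳ a)

·-identityˡ : ∀ {d} (x : Zd d) → (+ 1) · x ≡ x
·-identityˡ [] = refl
·-identityˡ (a ∷ x) = cong₂ _∷_ (ℤP.*-identityˡ a) (·-identityˡ x)

-·≡⊖· : ∀ {d} (a : ℤ) (x : Zd d) → (ℤ.- a) · x ≡ ⊖ (a · x)
-·≡⊖· a [] = refl
-·≡⊖· a (b ∷ x) = cong₂ _∷_ (sym (ℤP.neg-distribˡ-* a b)) (-·≡⊖· a x)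

-1·≡⊖ : ∀ {d} (x : Zd d) → -[1+ 0 ] · x ≡ ⊖ x
-1·≡⊖ x = trans (-·≡⊖· (+ 1) x) (cong ⊖_ (·-identityˡ x))

2·≡⊕ : ∀ {d} (x : Zd d) → (+ 2) · x ≡ x ⊕ x
2·≡⊕ x = trans (·-distribʳ-+ (+ 1) (+ 1) x) (cong₂ _⊕_ (·-identityˡ x) (·-identityˡ x))

<ₗ-trans : ∀ {d} {x y z : Zd d} → x <ₗ y → y <ₗ z → x <ₗ z
<ₗ-trans {x = []} {[]} {[]} () q
<ₗ-trans {x = a ∷ x} {b ∷ y} {c ∷ z} (inj₁ p) (inj₁ q) = inj₁ (ℤP.<-trans p q)
<ₗ-trans {x = a ∷ x} {b ∷ y} {c ∷ z} (inj₁ p) (inj₂ (refl , q)) = inj₁ p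
<ₗ-trans {x = a ∷ x} {b ∷ y} {c ∷ z} (inj₂ (refl , p)) (inj₁ q) = inj₁ q
<ₗ-trans {x = a ∷ x} {b ∷ y} {c ∷ z} (inj₂ (refl , p)) (inj₂ (refl , q)) = inj₂ (refl , <ₗ-trans p q)

<ₗ-irrefl : ∀ {d} {x : Zd d} → ¬ (x <ₗ x)
<ₗ-irrefl {x = a ∷ x} (inj₁ p) = ℤP.<-irrefl refl p
<ₗ-irrefl {x = a ∷ x} (inj₂ (_ , p)) = <ₗ-irrefl p

<ₗ-≤ₗ-trans : ∀ {d} {x y z : Zd d} → x <ₗ y → y ≤ₗ z → x <ₗ z
<ₗ-≤ₗ-trans p (inj₁ q) = <ₗ-trans p q
<ₗ-≤ₗ-trans p (inj₂ refl) = p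

≤ₗ-trans : ∀ {d} {x y z : Zd d} → x ≤ₗ y → y ≤ₗ z → x ≤ₗ z
≤ₗ-trans (inj₁ p) q = inj₁ (<ₗ-≤ₗ-trans p q)
≤ₗ-trans (inj₂ refl) q = q

<ₗ⇒≱ₗ : ∀ {d} {x y : Zd d} → x <ₗ y → ¬ (y ≤ₗ x)
<ₗ⇒≱ₗ p (inj₁ q) = <ₗ-irrefl (<ₗ-trans p q)
<ₗ⇒≱ₗ p (inj₂ refl) = <ₗ-irrefl p

⊕-monoˡ-<ₗ : ∀ {d} {x y : Zd d} (z : Zd d) → x <ₗ y → (x ⊕ z) <ₗ (y ⊕ z)
⊕-monoˡ-<ₗ {x = []} {[]} [] ()
⊕-monoˡ-<ₗ {x = a ∷ x} {b ∷ y} (c ∷ z) (inj₁ p) = inj₁ (ℤP.+-monoˡ-< c p)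
⊕-monoˡ-<ₗ {x = a ∷ x} {b ∷ y} (c ∷ z) (inj₂ (refl , p)) = inj₂ (refl , ⊕-monoˡ-<ₗ z p)

Positive : ∀ {d} → Zd d → Set
Positive x = 0v <ₗ x

NonNegative : ∀ {d} → Zd d → Set
NonNegative x = 0v ≤ₗ x

positive-⊕ : ∀ {d} {x y : Zd d} → Positive x → NonNegative y → Positive (x ⊕ y)
positive-⊕ {x = x} {y} p (inj₁ q) = <ₗ-trans q (subst (_<ₗ (x ⊕ y)) (⊕-identityˡ y) (⊕-monoˡ-<ₗ y p))
positive-⊕ {x = x} p (inj₂ refl) = subst Positive (sym (⊕-identityʳ x)) p

nonNegative-⊕ : ∀ {d} {x y : Zd d} → NonNegative x → NonNegative y → NonNegative (x ⊕ y)
nonNegative-⊕ (inj₁ p) q = inj₁ (positive-⊕ p q)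
nonNegative-⊕ {y = y} (inj₂ refl) q = subst NonNegative (sym (⊕-identityˡ y)) q

positive-scale : ∀ {d} {x : Zd d} (k : ℕ) → Positive x → Positive ((+ suc k) · x)
nonNegative-scale : ∀ {d} {x : Zd d} (k : ℕ) → NonNegative x → NonNegative ((+ k) · x)
positive-scale {x = x} k p = subst Positive (sym e) (positive-⊕ p (nonNegative-scale k (inj₁ p)))
  where
  e : (+ suc k) · x ≡ x ⊕ ((+ k) · x)
  e = trans (·-distribʳ-+ (+ 1) (+ k) x) (cong (_⊕ ((+ k) · x)) (·-identityˡ x))
nonNegative-scale {x = x} zero p = inj₂ (sym (·-zeroˡ x))
nonNegative-scale (suc k) (inj₁ p) = inj₁ (positive-scale k p)
nonNegative-scale (suc k) (inj₂ refl) = inj₂ (sym (·-zeroʳ (+ suc k)))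

<ₗ⇒positive : ∀ {d} {x y : Zd d} → x <ₗ y → Positive (y ⊕ (⊖ x))
<ₗ⇒positive {x = x} {y} p = subst (_<ₗ (y ⊕ (⊖ x))) (⊕-inverseʳ x) (⊕-monoˡ-<ₗ (⊖ x) p)

≤ₗ⇒nonNegative : ∀ {d} {x y : Zd d} → x ≤ₗ y → NonNegative (y ⊕ (⊖ x))
≤ₗ⇒nonNegative (inj₁ p) = inj₁ (<ₗ⇒positive p)
≤ₗ⇒nonNegative {x = x} (inj₂ refl) = inj₂ (sym (⊕-inverseʳ x))

positive⇒<ₗ : ∀ {d} {x y : Zd d} → Positive (y ⊕ (⊖ x)) → x <ₗ y
positive⇒<ₗ {x = x} {y} p = subst₂ _<ₗ_ (⊕-identityˡ x) (x⊖y⊕y≡x y x) (⊕-monoˡ-<ₗ x p)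

x<y⇒x⊖y<0 : ∀ {d} {x y : Zd d} → x <ₗ y → (x ⊕ (⊖ y)) <ₗ 0v
x<y⇒x⊖y<0 {x = x} {y} p = subst ((x ⊕ (⊖ y)) <ₗ_) (⊕-inverseʳ y) (⊕-monoˡ-<ₗ (⊖ y) p)

-- Certificates of infeasibility.  A contradiction among order facts about finitely
-- many "atoms" x₀ … x_{k-1} of ℤ^d is certified by adding positive and nonnegative
-- integer combinations of them to one whose coefficient vector is zero: the sum is
-- then 0v and positive at once.  The coefficients are computed by evaluation, so the
-- final check is refl.

_⊞_ : ∀ {k} → Vec ℤ k → Vec ℤ k → Vec ℤ k
_⊞_ = Data.Vec.zipWith ℤ._+_

_⊠_ : ∀ {k} → ℤ → Vec ℤ k → Vec ℤ k
c ⊠ p = Data.Vec.map (c ℤ.*_) p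

infixl 6 _⊞_
infixr 7 _⊠_

zeros : ∀ {k} → Vec ℤ k
zeros = Data.Vec.replicate _ (+ 0)

basis : ∀ {k} → Fin k → Vec ℤ k
basis Fin.zero = + 1 ∷ zeros
basis (Fin.suc p) = + 0 ∷ basis p

combine : ∀ {d k} → Vec ℤ k → Vec (Zd d) k → Zd d
combine [] [] = 0v
combine (c ∷ cs) (x ∷ xs) = (c · x) ⊕ combine cs xs

combine-⊞ : ∀ {d k} (p q : Vec ℤ k) (xs : Vec (Zd d) k) → combine (p ⊞ q) xs ≡ combine p xs ⊕ combine q xs
combine-⊞ [] [] [] = sym (⊕-identityˡ 0v)
combine-⊞ (a ∷ p) (b ∷ q) (x ∷ xs) =
  trans (cong₂ _⊕_ (·-distribʳ-+ a b x) (combine-⊞ p q xs)) (⊕-interchange (a · x) (b · x) (combine p xs) (combine q xs))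

combine-⊠ : ∀ {d k} (c : ℤ) (p : Vec ℤ k) (xs : Vec (Zd d) k) → combine (c ⊠ p) xs ≡ c · combine p xs
combine-⊠ c [] [] = sym (·-zeroʳ c)
combine-⊠ c (a ∷ p) (x ∷ xs) =
  trans (cong₂ _⊕_ (·-assoc c a x) (combine-⊠ c p xs)) (sym (·-distribˡ-⊕ c (a · x) (combine p xs)))

combine-zeros : ∀ {d k} (xs : Vec (Zd d) k) → combine zeros xs ≡ 0v
combine-zeros [] = refl
combine-zeros (x ∷ xs) = trans (cong₂ _⊕_ (·-zeroˡ x) (combine-zeros xs)) (⊕-identityˡ 0v)

combine-basis : ∀ {d k} (p : Fin k) (xs : Vec (Zd d) k) → combine (basis p) xs ≡ lookup xs p
combine-basis Fin.zero (x ∷ xs) = trans (cong₂ _⊕_ (·-identityˡ x) (combine-zeros xs)) (⊕-identityʳ x)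
combine-basis (Fin.suc p) (x ∷ xs) = trans (cong₂ _⊕_ (·-zeroˡ x) (combine-basis p xs)) (⊕-identityˡ _)

combine-difference : ∀ {d k} (c : ℤ) (p q : Fin k) (xs : Vec (Zd d) k) →
  combine (basis q ⊞ (ℤ.- c) ⊠ basis p) xs ≡ lookup xs q ⊕ (⊖ (c · lookup xs p))
combine-difference c p q xs = begin
  combine (basis q ⊞ (ℤ.- c) ⊠ basis p) xs              ≡⟨ combine-⊞ (basis q) ((ℤ.- c) ⊠ basis p) xs ⟩
  combine (basis q) xs ⊕ combine ((ℤ.- c) ⊠ basis p) xs ≡⟨ cong₂ _⊕_ (combine-basis q xs) (combine-⊠ (ℤ.- c) (basis p) xs) ⟩
  lookup xs q ⊕ ((ℤ.- c) · combine (basis p) xs)        ≡⟨ cong (λ w → lookup xs q ⊕ ((ℤ.- c) · w)) (combine-basis p xs) ⟩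
  lookup xs q ⊕ ((ℤ.- c) · lookup xs p)                 ≡⟨ cong (lookup xs q ⊕_) (-·≡⊖· c (lookup xs p)) ⟩
  lookup xs q ⊕ (⊖ (c · lookup xs p))                   ∎
  where open ≡-Reasoning

linearSum : ∀ {d} → List (ℤ × Zd d) → Zd d
linearSum [] = 0v
linearSum ((c , x) ∷ l) = (c · x) ⊕ linearSum l

coefficients : ∀ {k} → List (ℤ × Fin k) → Vec ℤ k
coefficients [] = zeros
coefficients ((c , p) ∷ ts) = c ⊠ basis p ⊞ coefficients ts

evaluate : ∀ {d k} → Vec (Zd d) k → List (ℤ × Fin k) → Zd d
evaluate xs [] = 0v
evaluate xs ((c , p) ∷ ts) = (c · lookup xs p) ⊕ evaluate xs ts

combine-coefficients : ∀ {d k} (xs : Vec (Zd d) k) (ts : List (ℤ × Fin k)) →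
  combine (coefficients ts) xs ≡ evaluate xs ts
combine-coefficients xs [] = combine-zeros xs
combine-coefficients xs ((c , p) ∷ ts) =
  trans (combine-⊞ (c ⊠ basis p) (coefficients ts) xs)
    (cong₂ _⊕_ (trans (combine-⊠ c (basis p) xs) (cong (c ·_) (combine-basis p xs))) (combine-coefficients xs ts))

module Certificate {d k : ℕ} (atoms : Vec (Zd d) k) where

  -- data wrappers, so that the coefficient vector is recoverable from the type
  data Pos (p : Vec ℤ k) : Set where
    pos : Positive (combine p atoms) → Pos p

  data NonNeg (p : Vec ℤ k) : Set where
    nonNeg : NonNegative (combine p atoms) → NonNeg p

  data Null (p : Vec ℤ k) : Set where
    null : combine p atoms ≡ 0v → Null p

  infixl 5 _+P_ _+N_ _+E_

  _+P_ : ∀ {p q} → Pos p → NonNeg q → Pos (p ⊞ q)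
  _+P_ {p} {q} (pos a) (nonNeg b) = pos (subst Positive (sym (combine-⊞ p q atoms)) (positive-⊕ a b))

  _+N_ : ∀ {p q} → NonNeg p → NonNeg q → NonNeg (p ⊞ q)
  _+N_ {p} {q} (nonNeg a) (nonNeg b) = nonNeg (subst NonNegative (sym (combine-⊞ p q atoms)) (nonNegative-⊕ a b))

  _+E_ : ∀ {p q} → Null p → Null q → Null (p ⊞ q)
  _+E_ {p} {q} (null a) (null b) = null (trans (combine-⊞ p q atoms) (trans (cong₂ _⊕_ a b) (⊕-identityˡ 0v)))

  P⇒N : ∀ {p} → Pos p → NonNeg p
  P⇒N (pos a) = nonNeg (inj₁ a)

  E⇒N : ∀ {p} → Null p → NonNeg p
  E⇒N (null a) = nonNeg (inj₂ (sym a))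

  scaleP : ∀ {p} (c : ℕ) → Pos p → Pos ((+ suc c) ⊠ p)
  scaleP {p} c (pos a) = pos (subst Positive (sym (combine-⊠ (+ suc c) p atoms)) (positive-scale c a))

  scaleN : ∀ {p} (c : ℕ) → NonNeg p → NonNeg ((+ c) ⊠ p)
  scaleN {p} c (nonNeg a) = nonNeg (subst NonNegative (sym (combine-⊠ (+ c) p atoms)) (nonNegative-scale c a))

  scaleE : ∀ {p} (c : ℤ) → Null p → Null (c ⊠ p)
  scaleE {p} c (null a) = null (trans (combine-⊠ c p atoms) (trans (cong (c ·_) a) (·-zeroʳ c)))

  refute : ∀ {a} {A : Set a} {p} → Pos p → p ≡ zeros → A
  refute (pos a) refl = ⊥-elim (<ₗ-irrefl (subst Positive (combine-zeros atoms) a))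

  Less : ℤ → Fin k → Fin k → Set
  Less c p q = Pos (basis q ⊞ (ℤ.- c) ⊠ basis p)

  LessEq : ℤ → Fin k → Fin k → Set
  LessEq c p q = NonNeg (basis q ⊞ (ℤ.- c) ⊠ basis p)

  scaled< : ∀ c p q → (c · lookup atoms p) <ₗ lookup atoms q → Less c p q
  scaled< c p q lt = pos (subst Positive (sym (combine-difference c p q atoms)) (<ₗ⇒positive lt))

  scaled≤ : ∀ c p q → (c · lookup atoms p) ≤ₗ lookup atoms q → LessEq c p q
  scaled≤ c p q le = nonNeg (subst NonNegative (sym (combine-difference c p q atoms)) (≤ₗ⇒nonNegative le))

  atom< : ∀ p q → lookup atoms p <ₗ lookup atoms q → Less (+ 1) p q
  atom< p q lt = scaled< (+ 1) p q (subst (_<ₗ lookup atoms q) (sym (·-identityˡ (lookup atoms p))) lt)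

  atom≤ : ∀ p q → lookup atoms p ≤ₗ lookup atoms q → LessEq (+ 1) p q
  atom≤ p q le = scaled≤ (+ 1) p q (subst (_≤ₗ lookup atoms q) (sym (·-identityˡ (lookup atoms p))) le)

  neg< : ∀ p q → (⊖ lookup atoms p) <ₗ lookup atoms q → Less -[1+ 0 ] p q
  neg< p q lt = scaled< -[1+ 0 ] p q (subst (_<ₗ lookup atoms q) (sym (-1·≡⊖ (lookup atoms p))) lt)

  atom>0 : ∀ p → 0v <ₗ lookup atoms p → Pos (basis p)
  atom>0 p lt = pos (subst Positive (sym (combine-basis p atoms)) lt)

  atom≡ : ∀ p q → lookup atoms p ≡ lookup atoms q → Null (basis p ⊞ -[1+ 0 ] ⊠ basis q)
  atom≡ p q e = null (trans (combine-difference (+ 1) q p atoms)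
    (trans (cong (λ w → lookup atoms p ⊕ (⊖ w)) (trans (·-identityˡ (lookup atoms q)) (sym e))) (⊕-inverseʳ (lookup atoms p))))

  scaled≡ : ∀ c p q → lookup atoms q ≡ c · lookup atoms p → Null (basis q ⊞ (ℤ.- c) ⊠ basis p)
  scaled≡ c p q e = null (trans (combine-difference c p q atoms) (trans (cong (_⊕ (⊖ (c · lookup atoms p))) e) (⊕-inverseʳ _)))

  relation : ∀ ts → evaluate atoms ts ≡ 0v → Null (coefficients ts)
  relation ts e = null (trans (combine-coefficients atoms ts) e)

  relation⁻¹ : ∀ ts → Null (coefficients ts) → evaluate atoms ts ≡ 0v
  relation⁻¹ ts (null e) = trans (sym (combine-coefficients atoms ts)) e

  scaled<⁻¹ : ∀ c p q → Less c p q → (c · lookup atoms p) <ₗ lookup atoms q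
  scaled<⁻¹ c p q (pos a) = positive⇒<ₗ (subst Positive (combine-difference c p q atoms) a)

module _ where
  open +-*-Solver

  master-relation : ∀ {d} (α β : ℤ) (c x y z : Zd d) → c ≡ (x ⊕ (β · z)) ⊕ (⊖ (α · y)) →
    linearSum ((+ 1 , c) ∷ (-[1+ 0 ] , x) ∷ (α , y) ∷ (ℤ.- β , z) ∷ []) ≡ 0v
  master-relation α β c x y z refl = go x y z
    where
    go : ∀ {d} (x y z : Zd d) →
      linearSum ((+ 1 , (x ⊕ (β · z)) ⊕ (⊖ (α · y))) ∷ (-[1+ 0 ] , x) ∷ (α , y) ∷ (ℤ.- β , z) ∷ []) ≡ 0v
    go [] [] [] = refl
    go (a ∷ x) (b ∷ y) (e ∷ z) = cong₂ _∷_
      (solve 5 (λ α β a b e → con (+ 1) :* ((a :+ β :* e) :- α :* b)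
                 :+ (con -[1+ 0 ] :* a :+ (α :* b :+ ((:- β) :* e :+ con (+ 0)))) := con (+ 0)) refl α β a b e)
      (go x y z)

  symmetric-relation : ∀ {d} (α β : ℤ) (h x y z : Zd d) → (⊖ (h ⊕ (⊖ x))) ⊕ (α · y) ≡ (h ⊕ (⊖ x)) ⊕ (β · z) →
    linearSum ((+ 2 , h) ∷ (-[1+ 1 ] , x) ∷ (ℤ.- α , y) ∷ (β , z) ∷ []) ≡ 0v
  symmetric-relation α β [] [] [] [] e = refl
  symmetric-relation α β (h ∷ hs) (x ∷ xs) (y ∷ ys) (z ∷ zs) e =
    cong₂ _∷_ head (symmetric-relation α β hs xs ys zs (∷-injectiveʳ e))
    where
    r : ℤ
    r = (h ℤ.- x) ℤ.+ β ℤ.* z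
    head : + 2 ℤ.* h ℤ.+ (-[1+ 1 ] ℤ.* x ℤ.+ ((ℤ.- α) ℤ.* y ℤ.+ (β ℤ.* z ℤ.+ + 0))) ≡ + 0
    head = trans (solve 6 (λ α β h x y z → con (+ 2) :* h :+ (con -[1+ 1 ] :* x :+ ((:- α) :* y :+ (β :* z :+ con (+ 0))))
                                          := ((h :- x) :+ β :* z) :- ((:- (h :- x)) :+ α :* y)) refl α β h x y z)
             (trans (cong (λ w → r ℤ.- w) (∷-injectiveˡ e)) (ℤP.+-inverseʳ r))

  gap-relation⇒gap : ∀ {d} (c x y : Zd d) → linearSum ((+ 1 , c) ∷ (-[1+ 1 ] , x) ∷ (+ 1 , y) ∷ []) ≡ 0v →
    y ⊕ (⊖ ((+ 2) · x)) ≡ ⊖ c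
  gap-relation⇒gap [] [] [] e = refl
  gap-relation⇒gap (c ∷ cs) (x ∷ xs) (y ∷ ys) e = cong₂ _∷_ head (gap-relation⇒gap cs xs ys (∷-injectiveʳ e))
    where
    head : y ℤ.+ ℤ.- (+ 2 ℤ.* x) ≡ ℤ.- c
    head = trans (solve 3 (λ c x y → y :- con (+ 2) :* x
                             := (con (+ 1) :* c :+ (con -[1+ 1 ] :* x :+ (con (+ 1) :* y :+ con (+ 0)))) :- c) refl c x y)
             (trans (cong (ℤ._- c) (∷-injectiveˡ e)) (ℤP.+-identityˡ (ℤ.- c)))

  shifted-pair-relation : ∀ {d} (g x y z : Zd d) → g ⊕ (⊖ x) ≡ ⊖ (y ⊕ z) →
    linearSum ((+ 1 , g) ∷ (-[1+ 0 ] , x) ∷ (+ 1 , y) ∷ (+ 1 , z) ∷ []) ≡ 0v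
  shifted-pair-relation [] [] [] [] e = refl
  shifted-pair-relation (g ∷ gs) (x ∷ xs) (y ∷ ys) (z ∷ zs) e = cong₂ _∷_ head (shifted-pair-relation gs xs ys zs (∷-injectiveʳ e))
    where
    head : + 1 ℤ.* g ℤ.+ (-[1+ 0 ] ℤ.* x ℤ.+ (+ 1 ℤ.* y ℤ.+ (+ 1 ℤ.* z ℤ.+ + 0))) ≡ + 0
    head = trans (solve 4 (λ g x y z → con (+ 1) :* g :+ (con -[1+ 0 ] :* x :+ (con (+ 1) :* y :+ (con (+ 1) :* z :+ con (+ 0))))
                                       := (g :- x) :- (:- (y :+ z))) refl g x y z)
             (trans (cong (λ w → w ℤ.- (ℤ.- (y ℤ.+ z))) (∷-injectiveˡ e)) (ℤP.+-inverseʳ (ℤ.- (y ℤ.+ z))))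

  double-pair-relation : ∀ {d} (x y z : Zd d) → ⊖ (x ⊕ x) ≡ ⊖ (y ⊕ z) →
    linearSum ((+ 2 , x) ∷ (-[1+ 0 ] , y) ∷ (-[1+ 0 ] , z) ∷ []) ≡ 0v
  double-pair-relation [] [] [] e = refl
  double-pair-relation (x ∷ xs) (y ∷ ys) (z ∷ zs) e = cong₂ _∷_ head (double-pair-relation xs ys zs (∷-injectiveʳ e))
    where
    head : + 2 ℤ.* x ℤ.+ (-[1+ 0 ] ℤ.* y ℤ.+ (-[1+ 0 ] ℤ.* z ℤ.+ + 0)) ≡ + 0
    head = trans (solve 3 (λ x y z → con (+ 2) :* x :+ (con -[1+ 0 ] :* y :+ (con -[1+ 0 ] :* z :+ con (+ 0)))
                                     := (:- (y :+ z)) :- (:- (x :+ x))) refl x y z)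
             (trans (cong (λ w → (ℤ.- (y ℤ.+ z)) ℤ.- w) (∷-injectiveˡ e)) (ℤP.+-inverseʳ (ℤ.- (y ℤ.+ z))))

  g⊖x≡⊖[x⊕z]⇒z≡⊖g : ∀ {d} (g x z : Zd d) → g ⊕ (⊖ x) ≡ ⊖ (x ⊕ z) → z ≡ ⊖ g
  g⊖x≡⊖[x⊕z]⇒z≡⊖g [] [] [] e = refl
  g⊖x≡⊖[x⊕z]⇒z≡⊖g (g ∷ gs) (x ∷ xs) (z ∷ zs) e = cong₂ _∷_ head (g⊖x≡⊖[x⊕z]⇒z≡⊖g gs xs zs (∷-injectiveʳ e))
    where
    head : z ≡ ℤ.- g
    head = trans (solve 3 (λ g x z → z := ((g :- x) :- (:- (x :+ z))) :- g) refl g x z)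
             (trans (cong (λ w → (w ℤ.- (ℤ.- (x ℤ.+ z))) ℤ.- g) (∷-injectiveˡ e))
               (trans (cong (ℤ._- g) (ℤP.+-inverseʳ (ℤ.- (x ℤ.+ z)))) (ℤP.+-identityˡ (ℤ.- g))))

  shift-equation : ∀ {d} (h x y a a' : Zd d) → (h ⊕ (⊖ x)) ⊕ a ≡ y ⊕ a' → h ⊕ (⊖ y) ≡ (x ⊕ a') ⊕ (⊖ a)
  shift-equation [] [] [] [] [] e = refl
  shift-equation (h ∷ hs) (x ∷ xs) (y ∷ ys) (a ∷ as) (b ∷ bs) e = cong₂ _∷_ head (shift-equation hs xs ys as bs (∷-injectiveʳ e))
    where
    head : h ℤ.- y ≡ (x ℤ.+ b) ℤ.- a
    head = trans (solve 5 (λ h x y a b → h :- y := ((h :- x) :+ a) :- y :+ x :- a) refl h x y a b)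
             (trans (cong (λ w → w ℤ.- y ℤ.+ x ℤ.- a) (∷-injectiveˡ e))
               (solve 5 (λ h x y a b → (y :+ b) :- y :+ x :- a := (x :+ b) :- a) refl h x y a b))

  g⊖[g⊖x]≡x : ∀ {d} (g x : Zd d) → g ⊕ (⊖ (g ⊕ (⊖ x))) ≡ x
  g⊖[g⊖x]≡x [] [] = refl
  g⊖[g⊖x]≡x (g ∷ gs) (x ∷ xs) = cong₂ _∷_ (solve 2 (λ g x → g :- (g :- x) := x) refl g x) (g⊖[g⊖x]≡x gs xs)

  g⊕[⊖g⊖x]≡⊖x : ∀ {d} (g x : Zd d) → g ⊕ (⊖ (⊖ ((⊖ g) ⊕ (⊖ x)))) ≡ ⊖ x
  g⊕[⊖g⊖x]≡⊖x [] [] = refl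
  g⊕[⊖g⊖x]≡⊖x (g ∷ gs) (x ∷ xs) =
    cong₂ _∷_ (solve 2 (λ g x → g :- (:- ((:- g) :- x)) := :- x) refl g x) (g⊕[⊖g⊖x]≡⊖x gs xs)

  ⊖[⊖g⊖b]≡g⊖⊖b : ∀ {d} (g b : Zd d) → ⊖ ((⊖ g) ⊕ (⊖ b)) ≡ g ⊕ (⊖ (⊖ b))
  ⊖[⊖g⊖b]≡g⊖⊖b [] [] = refl
  ⊖[⊖g⊖b]≡g⊖⊖b (g ∷ gs) (b ∷ bs) =
    cong₂ _∷_ (solve 2 (λ g b → :- ((:- g) :- b) := g :- (:- b)) refl g b) (⊖[⊖g⊖b]≡g⊖⊖b gs bs)

  ⊖[x⊕x]⊕x≡⊖x : ∀ {d} (x : Zd d) → (⊖ (x ⊕ x)) ⊕ x ≡ ⊖ x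
  ⊖[x⊕x]⊕x≡⊖x [] = refl
  ⊖[x⊕x]⊕x≡⊖x (a ∷ x) = cong₂ _∷_ (solve 1 (λ a → (:- (a :+ a)) :+ a := :- a) refl a) (⊖[x⊕x]⊕x≡⊖x x)

  s⊕y≡⊖x⇒s≡⊖[x⊕y] : ∀ {d} (s x y : Zd d) → s ⊕ y ≡ ⊖ x → s ≡ ⊖ (x ⊕ y)
  s⊕y≡⊖x⇒s≡⊖[x⊕y] [] [] [] e = refl
  s⊕y≡⊖x⇒s≡⊖[x⊕y] (s ∷ ss) (x ∷ xs) (y ∷ ys) e = cong₂ _∷_ head (s⊕y≡⊖x⇒s≡⊖[x⊕y] ss xs ys (∷-injectiveʳ e))
    where
    head : s ≡ ℤ.- (x ℤ.+ y)
    head = trans (solve 2 (λ s y → s := (s :+ y) :- y) refl s y)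
             (trans (cong (ℤ._- y) (∷-injectiveˡ e)) (solve 2 (λ x y → (:- x) :- y := :- (x :+ y)) refl x y))

  x⊕a⊖x≡a : ∀ {d} (x a : Zd d) → (x ⊕ a) ⊕ (⊖ ((+ 1) · x)) ≡ a
  x⊕a⊖x≡a [] [] = refl
  x⊕a⊖x≡a (p ∷ x) (q ∷ a) = cong₂ _∷_ (solve 2 (λ p q → (p :+ q) :- con (+ 1) :* p := q) refl p q) (x⊕a⊖x≡a x a)

  x⊖x⊖a≡⊖a : ∀ {d} (x a : Zd d) → (x ⊕ (-[1+ 0 ] · x)) ⊕ (⊖ a) ≡ ⊖ a
  x⊖x⊖a≡⊖a [] [] = refl
  x⊖x⊖a≡⊖a (p ∷ x) (q ∷ a) = cong₂ _∷_ (solve 2 (λ p q → (p :+ con -[1+ 0 ] :* p) :- q := :- q) refl p q) (x⊖x⊖a≡⊖a x a)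

  -- the one solution of the symmetric relation that does not force a contradiction
  symmetric-relation-at-zero : ∀ {d} (h x : Zd d) →
    (⊖ (h ⊕ (⊖ x))) ⊕ (-[1+ 0 ] · x) ≡ (h ⊕ (⊖ x)) ⊕ ((+ 1) · x) → (⊖ (h ⊕ (⊖ x))) ⊕ (-[1+ 0 ] · x) ≡ 0v
  symmetric-relation-at-zero [] [] e = refl
  symmetric-relation-at-zero (h ∷ hs) (x ∷ xs) e = cong₂ _∷_ head (symmetric-relation-at-zero hs xs (∷-injectiveʳ e))
    where
    -h≡h : ℤ.- h ≡ h
    -h≡h = trans (solve 2 (λ h x → :- h := (:- (h :- x)) :+ con -[1+ 0 ] :* x) refl h x)
             (trans (∷-injectiveˡ e) (solve 2 (λ h x → (h :- x) :+ con (+ 1) :* x := h) refl h x))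
    -i≡i⇒i≡0 : ∀ i → ℤ.- i ≡ i → i ≡ + 0
    -i≡i⇒i≡0 (+ zero) _ = refl
    -i≡i⇒i≡0 +[1+ n ] ()
    -i≡i⇒i≡0 -[1+ n ] ()
    head : ℤ.- (h ℤ.- x) ℤ.+ -[1+ 0 ] ℤ.* x ≡ + 0
    head = trans (solve 2 (λ h x → (:- (h :- x)) :+ con -[1+ 0 ] :* x := :- h) refl h x) (cong ℤ.-_ (-i≡i⇒i≡0 h -h≡h))

-- Co-minimality from unique representations

_≟ᵥ_ : ∀ {d} (x y : Zd d) → Dec (x ≡ y)
_≟ᵥ_ = ≡-dec ℤP._≟_

Unambiguous : ∀ {d} → Subset d → Subset d → Set
Unambiguous A B = ∀ {b b' a a'} → B b → B b' → A a → A a' → b ⊕ a ≡ b' ⊕ a' → b ≡ b' ⊎ b ⊕ a ≡ 0v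

nonzero-sum-with-one-of : ∀ {d} (x u₁ u₂ : Zd d) → u₁ ≢ u₂ → ∃ λ u → (u ≡ u₁ ⊎ u ≡ u₂) × x ⊕ u ≢ 0v
nonzero-sum-with-one-of x u₁ u₂ u₁≢u₂ with (x ⊕ u₁) ≟ᵥ 0v
... | no x⊕u₁≢0 = u₁ , inj₁ refl , x⊕u₁≢0
... | yes x⊕u₁≡0 = u₂ , inj₂ refl , λ x⊕u₂≡0 → u₁≢u₂ (⊕-cancelˡ x u₁ u₂ (trans x⊕u₁≡0 (sym x⊕u₂≡0)))

co-minimal-criterion : ∀ {d} (A B : Subset d) → Covers A B → Unambiguous A B →
  ∀ {a₁ a₂} → A a₁ → A a₂ → a₁ ≢ a₂ → ∀ y → ¬ A y → CoMinimalPair A B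
co-minimal-criterion {d} A B cover unamb {a₁} {a₂} a₁∈A a₂∈A a₁≢a₂ y y∉A =
  (a₁ , a₁∈A) , (b₁ , b₁∈B) , cover , A-minimal , B-minimal
  where
  b₁ : Zd d
  b₁ = proj₁ (proj₂ (cover 0v))

  b₁∈B : B b₁
  b₁∈B = proj₁ (proj₂ (proj₂ (proj₂ (cover 0v))))

  -- y ∉ A forces the representation of y ⊕ b₁ to use a second element of B
  b₂-rep : ∃ λ a → ∃ λ b → A a × B b × (a ⊕ b) ≡ (y ⊕ b₁)
  b₂-rep = cover (y ⊕ b₁)

  b₂ : Zd d
  b₂ = proj₁ (proj₂ b₂-rep)

  b₂∈B : B b₂
  b₂∈B = proj₁ (proj₂ (proj₂ (proj₂ b₂-rep)))

  b₁≢b₂ : b₁ ≢ b₂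
  b₁≢b₂ b₁≡b₂ with b₂-rep
  ... | a , _ , a∈A , _ , e = y∉A (subst A (⊕-cancelʳ b₁ a y (trans (cong (a ⊕_) b₁≡b₂) e)) a∈A)

  A-minimal : ∀ (A' : Subset d) → NonemptyProperSubset A' A → ¬ Covers A' B
  A-minimal A' (A'⊆A , _ , x , x∈A , x∉A') cover' with nonzero-sum-with-one-of x b₁ b₂ b₁≢b₂
  ... | b , which , x⊕b≢0 with cover' (x ⊕ b)
  ...   | a , b' , a∈A' , b'∈B , e with unamb b'∈B ([ (λ { refl → b₁∈B }) , (λ { refl → b₂∈B }) ]′ which)
                                       (A'⊆A a∈A') x∈A (trans (⊕-comm b' a) (trans e (⊕-comm x b)))
  ...     | inj₁ refl = x∉A' (subst A' (⊕-cancelˡ b' a x (trans (⊕-comm b' a) (trans e (⊕-comm x b')))) a∈A')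
  ...     | inj₂ b'⊕a≡0 = x⊕b≢0 (trans (sym (trans (⊕-comm b' a) e)) b'⊕a≡0)

  B-minimal : ∀ (B' : Subset d) → NonemptyProperSubset B' B → ¬ Covers A B'
  B-minimal B' (B'⊆B , _ , x , x∈B , x∉B') cover' with nonzero-sum-with-one-of x a₁ a₂ a₁≢a₂
  ... | a , which , x⊕a≢0 with cover' (a ⊕ x)
  ...   | a' , b' , a'∈A , b'∈B' , e with unamb (B'⊆B b'∈B') x∈B a'∈A ([ (λ { refl → a₁∈A }) , (λ { refl → a₂∈A }) ]′ which)
                                        (trans (⊕-comm b' a') (trans e (⊕-comm a x)))
  ...     | inj₁ b'≡x = x∉B' (subst B' b'≡x b'∈B')
  ...     | inj₂ b'⊕a'≡0 = x⊕a≢0 (trans (sym (trans (⊕-comm b' a') (trans e (⊕-comm a x)))) b'⊕a'≡0)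

-- An enumeration of ℤ^d

next-pair : ℕ × ℕ → ℕ × ℕ
next-pair (zero , b) = suc b , zero
next-pair (suc a , b) = a , suc b

-- walks the anti-diagonals a + b = 0, 1, 2, …
unpair : ℕ → ℕ × ℕ
unpair zero = zero , zero
unpair (suc k) = next-pair (unpair k)

unpair-reaches : ∀ s b → b ℕ.≤ s → ∃ λ k → unpair k ≡ (s ℕ.∸ b , b)
unpair-reaches zero zero _ = zero , refl
unpair-reaches (suc s) zero _ with unpair-reaches s s ℕP.≤-refl
... | k , e = suc k , cong next-pair (trans e (cong (_, s) (ℕP.n∸n≡0 s)))
unpair-reaches s (suc b) b<s with unpair-reaches s b (ℕP.<⇒≤ b<s)
... | k , e = suc k , cong next-pair (trans e (cong (_, b) (ℕP.+-∸-assoc 1 b<s)))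

unpair-surjective : ∀ a b → ∃ λ k → unpair k ≡ (a , b)
unpair-surjective a b with unpair-reaches (a + b) b (ℕP.m≤n+m b a)
... | k , e = k , trans e (cong (_, b) (ℕP.m+n∸n≡m a b))

enumerateℤ : ℕ → ℤ
enumerateℤ k = (+ proj₁ (unpair k)) ℤ.- (+ proj₂ (unpair k))

enumerateℤ-surjective : ∀ z → ∃ λ k → enumerateℤ k ≡ z
enumerateℤ-surjective (+ a) with unpair-surjective a 0
... | k , e = k , trans (cong (λ p → (+ proj₁ p) ℤ.- (+ proj₂ p)) e) (ℤP.+-identityʳ (+ a))
enumerateℤ-surjective -[1+ a ] with unpair-surjective 0 (suc a)
... | k , e = k , cong (λ p → (+ proj₁ p) ℤ.- (+ proj₂ p)) e

enumerate : ∀ d → ℕ → Zd d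
enumerate zero _ = []
enumerate (suc d) k = enumerateℤ (proj₁ (unpair k)) ∷ enumerate d (proj₂ (unpair k))

enumerate-surjective : ∀ {d} (x : Zd d) → ∃ λ k → enumerate d k ≡ x
enumerate-surjective [] = zero , refl
enumerate-surjective {suc d} (z ∷ x) with enumerateℤ-surjective z | enumerate-surjective x
... | i , eᵢ | j , eⱼ with unpair-surjective i j
... | k , e = k , cong₂ _∷_ (trans (cong (λ p → enumerateℤ (proj₁ p)) e) eᵢ) (trans (cong (λ p → enumerate d (proj₂ p)) e) eⱼ)

Eventually : (ℕ → Set) → Set
Eventually P = ∃ λ K → ∀ m → K ℕ.≤ m → P m

eventually-× : ∀ {P Q : ℕ → Set} → Eventually P → Eventually Q → Eventually (λ m → P m × Q m)
eventually-× (K₁ , p) (K₂ , q) =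
  K₁ ℕ.⊔ K₂ , λ m K≤m → p m (ℕP.≤-trans (ℕP.m≤m⊔n K₁ K₂) K≤m) , q m (ℕP.≤-trans (ℕP.m≤n⊔m K₁ K₂) K≤m)

eventually-∀∈ : ∀ {A : Set} (L : List A) {P : A → ℕ → Set} →
  (∀ {b} → b ∈ L → Eventually (P b)) → Eventually (λ m → ∀ {b} → b ∈ L → P b m)
eventually-∀∈ [] _ = 0 , λ _ _ ()
eventually-∀∈ (x ∷ L) ev with eventually-× (ev (here refl)) (eventually-∀∈ L (λ b∈L → ev (there b∈L)))
... | K , f = K , λ { m K≤m (here refl) → proj₁ (f m K≤m) ; m K≤m (there b∈L) → proj₂ (f m K≤m) b∈L }

-- Greedy construction of complements

CoveredBy : ∀ {d} → Subset d → List (Zd d) → Zd d → Set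
CoveredBy A L g = Any (λ b → A (g ⊕ (⊖ b))) L

module GreedyUnion {d : ℕ} (A : Subset d) (A? : ∀ x → Dec (A x))
  (Invariant : List (Zd d) → Set) (L₀ : List (Zd d)) (inv₀ : Invariant L₀)
  (extend : ∀ L → Invariant L → ∀ g → ¬ CoveredBy A L g →
            ∃ λ N → Invariant (N ++ L) × CoveredBy A (N ++ L) g) where

  Stage : Set
  Stage = Σ (List (Zd d)) Invariant

  cover-point : (s : Stage) (g : Zd d) →
    Σ Stage λ s' → (∀ {b} → b ∈ proj₁ s → b ∈ proj₁ s') × CoveredBy A (proj₁ s') g
  cover-point (L , inv) g with any? (λ b → A? (g ⊕ (⊖ b))) L
  ... | yes covered = (L , inv) , (λ b∈L → b∈L) , covered
  ... | no uncovered with extend L inv g uncovered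
  ...   | N , inv' , covered = (N ++ L , inv') , ∈-++⁺ʳ N , covered

  stage : ℕ → Stage
  stage zero = L₀ , inv₀
  stage (suc k) = proj₁ (cover-point (stage k) (enumerate d k))

  stage-mono : ∀ j {k b} → b ∈ proj₁ (stage k) → b ∈ proj₁ (stage (j + k))
  stage-mono zero b∈ = b∈
  stage-mono (suc j) {k} b∈ = proj₁ (proj₂ (cover-point (stage (j + k)) (enumerate d (j + k)))) (stage-mono j b∈)

  Union : Subset d
  Union b = ∃ λ k → b ∈ proj₁ (stage k)

  common-stage : ∀ {b b'} → Union b → Union b' → ∃ λ k → b ∈ proj₁ (stage k) × b' ∈ proj₁ (stage k)
  common-stage {b} {b'} (k , b∈) (k' , b'∈) =
    k' + k , stage-mono k' b∈ , subst (λ w → b' ∈ proj₁ (stage w)) (ℕP.+-comm k k') (stage-mono k b'∈)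

  Union-unambiguous : (∀ {L} → Invariant L → Unambiguous A (λ b → b ∈ L)) → Unambiguous A Union
  Union-unambiguous unamb {b} {b'} b∈ b'∈ = unamb (proj₂ (stage k)) (proj₁ (proj₂ common)) (proj₂ (proj₂ common))
    where
    common : ∃ λ k → b ∈ proj₁ (stage k) × b' ∈ proj₁ (stage k)
    common = common-stage b∈ b'∈
    k : ℕ
    k = proj₁ common

  Union-covers : Covers A Union
  Union-covers g with enumerate-surjective g
  ... | k , refl with find (proj₂ (proj₂ (cover-point (stage k) (enumerate d k))))
  ...   | b , b∈ , a∈A = enumerate d k ⊕ (⊖ b) , b , a∈A , (suc k , b∈) , x⊖y⊕y≡x (enumerate d k) b

data Sign : Set where
  σ⁺ σ⁰ σ⁻ : Sign

⟦_⟧ : Sign → ℤ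
⟦ σ⁺ ⟧ = + 1
⟦ σ⁰ ⟧ = + 0
⟦ σ⁻ ⟧ = -[1+ 0 ]

module LacunarySequence {d : ℕ} (t : ℕ → Zd d)
  (t-increasing : ∀ n → t n <ₗ t (suc n))
  (t₀-positive : 0v <ₗ t 0)
  (t-doubling : ∀ n → ((+ 2) · t n) ≤ₗ t (suc n)) where

  t-mono< : ∀ {i j} → i ℕ.< j → t i <ₗ t j
  t-mono< {i} {suc j} (ℕ.s≤s i≤j) with ℕP.m≤n⇒m<n∨m≡n i≤j
  ... | inj₁ i<j = <ₗ-trans (t-mono< i<j) (t-increasing j)
  ... | inj₂ refl = t-increasing j

  t-mono≤ : ∀ {i j} → i ℕ.≤ j → t i ≤ₗ t j
  t-mono≤ i≤j with ℕP.m≤n⇒m<n∨m≡n i≤j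
  ... | inj₁ i<j = inj₁ (t-mono< i<j)
  ... | inj₂ refl = inj₂ refl

  t-positive : ∀ i → 0v <ₗ t i
  t-positive zero = t₀-positive
  t-positive (suc i) = <ₗ-trans (t-positive i) (t-increasing i)

  t-double≤ : ∀ {i j} → i ℕ.< j → ((+ 2) · t i) ≤ₗ t j
  t-double≤ {i} i<j = ≤ₗ-trans (t-doubling i) (t-mono≤ i<j)

  Bounded : Zd d → ℕ → Set
  Bounded x m = (x <ₗ t m) × ((⊖ x) <ₗ t m)

  W-signed : ∀ {a} → WSet t a → Σ Sign λ σ → Σ ℕ λ i → a ≡ ⟦ σ ⟧ · t i
  W-signed (inj₁ (i , refl)) = σ⁺ , i , sym (·-identityˡ (t i))
  W-signed (inj₂ (inj₁ refl)) = σ⁰ , 0 , sym (·-zeroˡ (t 0))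
  W-signed {a} (inj₂ (inj₂ (i , e))) = σ⁻ , i , trans (sym (⊖-involutive a)) (trans (cong ⊖_ (sym e)) (sym (-1·≡⊖ (t i))))

  Gap : Zd d → ℕ → Set
  Gap c n = linearSum ((+ 1 , c) ∷ (-[1+ 1 ] , t n) ∷ (+ 1 , t (suc n)) ∷ []) ≡ 0v

  Degenerate : Zd d → ℕ → Set
  Degenerate h n = linearSum ((+ 2 , h) ∷ (-[1+ 2 ] , t n) ∷ (+ 1 , t (suc n)) ∷ []) ≡ 0v

  Bounded-double : ∀ {x m} → Bounded (x ⊕ x) m → (((+ 2) · x) <ₗ t m) × ((-[1+ 1 ] · x) <ₗ t m)
  Bounded-double {x} {m} (lt , neg-lt) =
    subst (_<ₗ t m) (sym (2·≡⊕ x)) lt , subst (_<ₗ t m) (sym (trans (-·≡⊖· (+ 2) x) (cong ⊖_ (2·≡⊕ x)))) neg-lt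

  module T-difference (c : Zd d) (m : ℕ) (bd : Bounded c m) (ng : ¬ Gap c (suc m)) (i j : ℕ) where
    n : ℕ
    n = suc m
    open Certificate (c ∷ t n ∷ t i ∷ t j ∷ t m ∷ t (suc n) ∷ [])

    Eq : Set
    Eq = c ≡ (t n ⊕ ((+ 1) · t j)) ⊕ (⊖ ((+ 1) · t i))

    terms : List (ℤ × Fin 6)
    terms = (+ 1 , # 0) ∷ (-[1+ 0 ] , # 1) ∷ (+ 1 , # 2) ∷ (-[1+ 0 ] , # 3) ∷ []

    E : Eq → Null (coefficients terms)
    E eq = relation terms (master-relation (+ 1) (+ 1) c (t n) (t i) (t j) eq)

    c<tₘ : Less (+ 1) (# 0) (# 4)
    c<tₘ = atom< (# 0) (# 4) (proj₁ bd)

    -c<tₘ : Less -[1+ 0 ] (# 0) (# 4)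
    -c<tₘ = neg< (# 0) (# 4) (proj₂ bd)

    tₘ<tₙ : LessEq (+ 1) (# 4) (# 1)
    tₘ<tₙ = P⇒N (atom< (# 4) (# 1) (t-mono< (ℕP.n<1+n m)))

    2tₘ≤tₙ : LessEq (+ 2) (# 4) (# 1)
    2tₘ≤tₙ = scaled≤ (+ 2) (# 4) (# 1) (t-doubling m)

    2tₙ≤tₙ₊₁ : LessEq (+ 2) (# 1) (# 5)
    2tₙ≤tₙ₊₁ = scaled≤ (+ 2) (# 1) (# 5) (t-doubling n)

    tₘ>0 : NonNeg (basis (# 4))
    tₘ>0 = P⇒N (atom>0 (# 4) (t-positive m))

    tⱼ>0 : NonNeg (basis (# 3))
    tⱼ>0 = P⇒N (atom>0 (# 3) (t-positive j))

    unique : Eq → c ≡ (+ 1) · t j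
    unique eq with ℕP.<-cmp i n
    ... | tri≈ _ i≡n _ =
      trans (subst (λ k → c ≡ (t n ⊕ ((+ 1) · t j)) ⊕ (⊖ ((+ 1) · t k))) i≡n eq) (x⊕a⊖x≡a (t n) ((+ 1) · t j))
    ... | tri< i<n _ _ =
      refute (c<tₘ +P atom≤ (# 2) (# 4) (t-mono≤ (ℕP.≤-pred i<n)) +P 2tₘ≤tₙ +P tⱼ>0 +P E⇒N (E eq)) refl
    ... | tri> _ _ n<i with ℕP.≤-<-connex i j
    ...   | inj₁ i≤j = refute (c<tₘ +P tₘ<tₙ +P atom≤ (# 2) (# 3) (t-mono≤ i≤j) +P E⇒N (E eq)) refl
    ...   | inj₂ j<i with ℕP.<-cmp j n
    ...     | tri< j<n _ _ = refute (-c<tₘ +P scaled≤ (+ 2) (# 1) (# 2) (t-double≤ n<i)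
                                     +P atom≤ (# 3) (# 4) (t-mono≤ (ℕP.≤-pred j<n)) +P 2tₘ≤tₙ +P E⇒N (scaleE -[1+ 0 ] (E eq))) refl
    ...     | tri> _ _ n<j = refute (-c<tₘ +P scaled≤ (+ 2) (# 3) (# 2) (t-double≤ j<i)
                                     +P scaled≤ (+ 2) (# 1) (# 3) (t-double≤ n<j) +P tₘ<tₙ +P E⇒N (scaleE -[1+ 0 ] (E eq))) refl
    ...     | tri≈ _ j≡n _ with ℕP.m≤n⇒m<n∨m≡n n<i
    ...       | inj₁ n+1<i = refute (-c<tₘ +P scaled≤ (+ 2) (# 5) (# 2) (t-double≤ n+1<i) +P scaleN 2 2tₙ≤tₙ₊₁
                                     +P scaleN 2 tₘ<tₙ +P tₘ>0 +P E⇒N (atom≡ (# 1) (# 3) (cong t (sym j≡n)))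
                                     +P E⇒N (scaleE -[1+ 0 ] (E eq))) refl
    ...       | inj₂ n+1≡i = ⊥-elim (ng (relation⁻¹ ((+ 1 , # 0) ∷ (-[1+ 1 ] , # 1) ∷ (+ 1 , # 5) ∷ [])
                                 (E eq +E atom≡ (# 5) (# 2) (cong t n+1≡i) +E atom≡ (# 3) (# 1) (cong t j≡n))))

  -- without ¬ Gap, a = t_{m+2} and a' = t_{m+1} would be a further solution
  T-difference-unique : ∀ c m → Bounded c m → ¬ Gap c (suc m) → ∀ {a a'} → TSet t a → TSet t a' →
    c ≡ (t (suc m) ⊕ a') ⊕ (⊖ a) → c ≡ a'
  T-difference-unique c m bd ng (i , refl) (j , refl) eq =
    trans (T-difference.unique c m bd ng i j
             (subst₂ (λ u w → c ≡ (t (suc m) ⊕ w) ⊕ (⊖ u)) (sym (·-identityˡ (t i))) (sym (·-identityˡ (t j))) eq))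
          (·-identityˡ (t j))

  double-not-sum-of-distinct : ∀ b a c → a ≢ c → ⊖ (t b ⊕ t b) ≢ ⊖ (t a ⊕ t c)
  double-not-sum-of-distinct b a c a≢c eq = contradiction
    where
    open Certificate (t b ∷ t a ∷ t c ∷ [])

    E : Null (coefficients ((+ 2 , # 0) ∷ (-[1+ 0 ] , # 1) ∷ (-[1+ 0 ] , # 2) ∷ []))
    E = relation ((+ 2 , # 0) ∷ (-[1+ 0 ] , # 1) ∷ (-[1+ 0 ] , # 2) ∷ []) (double-pair-relation (t b) (t a) (t c) eq)

    E⁻ : NonNeg (-[1+ 0 ] ⊠ coefficients ((+ 2 , # 0) ∷ (-[1+ 0 ] , # 1) ∷ (-[1+ 0 ] , # 2) ∷ []))
    E⁻ = E⇒N (scaleE -[1+ 0 ] E)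

    contradiction : ⊥
    contradiction with ℕP.<-cmp a b | ℕP.<-cmp c b
    ... | tri> _ _ b<a | _ = refute (atom>0 (# 2) (t-positive c) +P scaled≤ (+ 2) (# 0) (# 1) (t-double≤ b<a) +P E⇒N E) refl
    ... | _ | tri> _ _ b<c = refute (atom>0 (# 1) (t-positive a) +P scaled≤ (+ 2) (# 0) (# 2) (t-double≤ b<c) +P E⇒N E) refl
    ... | tri< a<b _ _ | tri< c<b _ _ = refute (atom< (# 1) (# 0) (t-mono< a<b) +P P⇒N (atom< (# 2) (# 0) (t-mono< c<b)) +P E⁻) refl
    ... | tri≈ _ a≡b _ | tri< c<b _ _ = refute (atom< (# 2) (# 0) (t-mono< c<b) +P E⁻ +P E⇒N (atom≡ (# 0) (# 1) (cong t (sym a≡b)))) refl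
    ... | tri< a<b _ _ | tri≈ _ c≡b _ = refute (atom< (# 1) (# 0) (t-mono< a<b) +P E⁻ +P E⇒N (atom≡ (# 0) (# 2) (cong t (sym c≡b)))) refl
    ... | tri≈ _ a≡b _ | tri≈ _ c≡b _ = a≢c (trans a≡b (sym c≡b))

  shifted-not-minus-sum-of-distinct : ∀ g m → Bounded (g ⊕ g) m → ¬ TSet t (⊖ g) → ∀ a c → a ≢ c →
    g ⊕ (⊖ t (suc m)) ≢ ⊖ (t a ⊕ t c)
  shifted-not-minus-sum-of-distinct g m bd g∉-T a c a≢c eq = contradiction
    where
    n : ℕ
    n = suc m
    open Certificate (g ∷ t n ∷ t a ∷ t c ∷ t m ∷ [])

    terms : List (ℤ × Fin 5)
    terms = (+ 1 , # 0) ∷ (-[1+ 0 ] , # 1) ∷ (+ 1 , # 2) ∷ (+ 1 , # 3) ∷ []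

    E : Null (coefficients terms)
    E = relation terms (shifted-pair-relation g (t n) (t a) (t c) eq)

    2g<tₘ : Less (+ 2) (# 0) (# 4)
    2g<tₘ = scaled< (+ 2) (# 0) (# 4) (proj₁ (Bounded-double bd))

    -2g<tₘ : Less -[1+ 1 ] (# 0) (# 4)
    -2g<tₘ = scaled< -[1+ 1 ] (# 0) (# 4) (proj₂ (Bounded-double bd))

    tₘ<tₙ : LessEq (+ 1) (# 4) (# 1)
    tₘ<tₙ = P⇒N (atom< (# 4) (# 1) (t-mono< (ℕP.n<1+n m)))

    2tₘ≤tₙ : LessEq (+ 2) (# 4) (# 1)
    2tₘ≤tₙ = scaled≤ (+ 2) (# 4) (# 1) (t-doubling m)

    tₙ>0 : NonNeg (basis (# 1))
    tₙ>0 = P⇒N (atom>0 (# 1) (t-positive n))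

    contradiction : ⊥
    contradiction with ℕP.<-cmp a n
    ... | tri≈ _ a≡n _ =
      g∉-T (c , g⊖x≡⊖[x⊕z]⇒z≡⊖g g (t n) (t c) (subst (λ k → g ⊕ (⊖ t n) ≡ ⊖ (t k ⊕ t c)) a≡n eq))
    ... | tri> _ _ n<a = refute (-2g<tₘ +P scaleN 2 (scaled≤ (+ 2) (# 1) (# 2) (t-double≤ n<a)) +P tₘ<tₙ +P tₙ>0
                                 +P scaleN 2 (P⇒N (atom>0 (# 3) (t-positive c))) +P scaleN 2 (E⇒N (scaleE -[1+ 0 ] E))) refl
    ... | tri< a<n _ _ with ℕP.<-cmp c n
    ...   | tri≈ _ c≡n _ = g∉-T (a , g⊖x≡⊖[x⊕z]⇒z≡⊖g g (t n) (t a)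
                                      (trans (subst (λ k → g ⊕ (⊖ t n) ≡ ⊖ (t a ⊕ t k)) c≡n eq) (cong ⊖_ (⊕-comm (t a) (t n)))))
    ...   | tri> _ _ n<c = refute (-2g<tₘ +P scaleN 2 (scaled≤ (+ 2) (# 1) (# 3) (t-double≤ n<c)) +P tₘ<tₙ +P tₙ>0
                                   +P scaleN 2 (P⇒N (atom>0 (# 2) (t-positive a))) +P scaleN 2 (E⇒N (scaleE -[1+ 0 ] E))) refl
    ...   | tri< c<n _ _ with ℕP.<-cmp a c
    ...     | tri≈ _ a≡c _ = a≢c a≡c
    ...     | tri< a<c _ _ = refute (2g<tₘ +P scaled≤ (+ 2) (# 2) (# 3) (t-double≤ a<c)
                                     +P scaleN 3 (atom≤ (# 3) (# 4) (t-mono≤ (ℕP.≤-pred c<n)))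
                                     +P scaleN 2 2tₘ≤tₙ +P scaleN 2 (E⇒N E)) refl
    ...     | tri> _ _ c<a = refute (2g<tₘ +P scaled≤ (+ 2) (# 3) (# 2) (t-double≤ c<a)
                                     +P scaleN 3 (atom≤ (# 2) (# 4) (t-mono≤ (ℕP.≤-pred a<n)))
                                     +P scaleN 2 2tₘ≤tₙ +P scaleN 2 (E⇒N E)) refl

  sextupling⇒tripling : (∀ n → ((+ 6) · t n) ≤ₗ t (suc n)) → ∀ n → ((+ 3) · t n) <ₗ t (suc n)
  sextupling⇒tripling t-sextupling n =
    scaled<⁻¹ (+ 3) (# 1) (# 0) (scaleP 2 (atom>0 (# 1) (t-positive n)) +P scaled≤ (+ 6) (# 1) (# 0) (t-sextupling n))
    where open Certificate (t (suc n) ∷ t n ∷ [])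

  Degenerate? : ∀ h n → Dec (Degenerate h n)
  Degenerate? h n = linearSum ((+ 2 , h) ∷ (-[1+ 2 ] , t n) ∷ (+ 1 , t (suc n)) ∷ []) ≟ᵥ 0v

  module Sparse (t-tripling : ∀ n → ((+ 3) · t n) <ₗ t (suc n)) where

    t-triple< : ∀ {i j} → i ℕ.< j → ((+ 3) · t i) <ₗ t j
    t-triple< {i} i<j = <ₗ-≤ₗ-trans (t-tripling i) (t-mono≤ i<j)

    module W-difference (c : Zd d) (m : ℕ) (bd : Bounded c m) (i j : ℕ) where
      n : ℕ
      n = suc m
      open Certificate (c ∷ t n ∷ t i ∷ t j ∷ t m ∷ [])

      Eq : Sign → Sign → Set
      Eq σa σb = c ≡ (t n ⊕ (⟦ σb ⟧ · t j)) ⊕ (⊖ (⟦ σa ⟧ · t i))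

      terms : Sign → Sign → List (ℤ × Fin 5)
      terms σa σb = (+ 1 , # 0) ∷ (-[1+ 0 ] , # 1) ∷ (⟦ σa ⟧ , # 2) ∷ (ℤ.- ⟦ σb ⟧ , # 3) ∷ []

      E⁺ : ∀ σa σb → Eq σa σb → NonNeg (coefficients (terms σa σb))
      E⁺ σa σb eq = E⇒N (relation (terms σa σb) (master-relation ⟦ σa ⟧ ⟦ σb ⟧ c (t n) (t i) (t j) eq))

      E⁻ : ∀ σa σb → Eq σa σb → NonNeg (-[1+ 0 ] ⊠ coefficients (terms σa σb))
      E⁻ σa σb eq = E⇒N (scaleE -[1+ 0 ] (relation (terms σa σb) (master-relation ⟦ σa ⟧ ⟦ σb ⟧ c (t n) (t i) (t j) eq)))

      c<tₘ : Less (+ 1) (# 0) (# 4)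
      c<tₘ = atom< (# 0) (# 4) (proj₁ bd)

      -c<tₘ : Less -[1+ 0 ] (# 0) (# 4)
      -c<tₘ = neg< (# 0) (# 4) (proj₂ bd)

      3tₘ<tₙ : LessEq (+ 3) (# 4) (# 1)
      3tₘ<tₙ = P⇒N (scaled< (+ 3) (# 4) (# 1) (t-tripling m))

      tₘ<tₙ : LessEq (+ 1) (# 4) (# 1)
      tₘ<tₙ = P⇒N (atom< (# 4) (# 1) (t-mono< (ℕP.n<1+n m)))

      tₘ>0 : NonNeg (basis (# 4))
      tₘ>0 = P⇒N (atom>0 (# 4) (t-positive m))

      tₙ>0 : NonNeg (basis (# 1))
      tₙ>0 = P⇒N (atom>0 (# 1) (t-positive n))

      tᵢ>0 : NonNeg (basis (# 2))
      tᵢ>0 = P⇒N (atom>0 (# 2) (t-positive i))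

      tⱼ>0 : NonNeg (basis (# 3))
      tⱼ>0 = P⇒N (atom>0 (# 3) (t-positive j))

      tᵢ≤tₘ : i ℕ.< n → LessEq (+ 1) (# 2) (# 4)
      tᵢ≤tₘ p = atom≤ (# 2) (# 4) (t-mono≤ (ℕP.≤-pred p))

      tⱼ≤tₘ : j ℕ.< n → LessEq (+ 1) (# 3) (# 4)
      tⱼ≤tₘ p = atom≤ (# 3) (# 4) (t-mono≤ (ℕP.≤-pred p))

      tᵢ≤tⱼ : i ℕ.≤ j → LessEq (+ 1) (# 2) (# 3)
      tᵢ≤tⱼ p = atom≤ (# 2) (# 3) (t-mono≤ p)

      tⱼ≤tᵢ : j ℕ.≤ i → LessEq (+ 1) (# 3) (# 2)
      tⱼ≤tᵢ p = atom≤ (# 3) (# 2) (t-mono≤ p)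

      3tₙ<tⱼ : n ℕ.< j → LessEq (+ 3) (# 1) (# 3)
      3tₙ<tⱼ p = P⇒N (scaled< (+ 3) (# 1) (# 3) (t-triple< p))

      3tₙ<tᵢ : n ℕ.< i → LessEq (+ 3) (# 1) (# 2)
      3tₙ<tᵢ p = P⇒N (scaled< (+ 3) (# 1) (# 2) (t-triple< p))

      3tⱼ<tᵢ : j ℕ.< i → LessEq (+ 3) (# 3) (# 2)
      3tⱼ<tᵢ p = P⇒N (scaled< (+ 3) (# 3) (# 2) (t-triple< p))

      3tᵢ<tⱼ : i ℕ.< j → LessEq (+ 3) (# 2) (# 3)
      3tᵢ<tⱼ p = P⇒N (scaled< (+ 3) (# 2) (# 3) (t-triple< p))

      Result : Sign → Sign → Set
      Result σa σb = (c ≡ ⟦ σb ⟧ · t j) ⊎ (c ≡ ⊖ (⟦ σa ⟧ · t i))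

      a≡tₙ : ∀ σb → i ≡ n → Eq σ⁺ σb → Result σ⁺ σb
      a≡tₙ σb i≡n eq = inj₁ (trans (subst (λ k → c ≡ (t n ⊕ (⟦ σb ⟧ · t j)) ⊕ (⊖ ((+ 1) · t k))) i≡n eq)
                                      (x⊕a⊖x≡a (t n) (⟦ σb ⟧ · t j)))

      a'≡-tₙ : ∀ σa → j ≡ n → Eq σa σ⁻ → Result σa σ⁻
      a'≡-tₙ σa j≡n eq = inj₂ (trans (subst (λ k → c ≡ (t n ⊕ (-[1+ 0 ] · t k)) ⊕ (⊖ (⟦ σa ⟧ · t i))) j≡n eq)
                                        (x⊖x⊖a≡⊖a (t n) (⟦ σa ⟧ · t i)))

      unique : ∀ σa σb → Eq σa σb → Result σa σb
      unique σ⁰ σ⁰ eq = refute (c<tₘ +P tₘ<tₙ +P E⁺ σ⁰ σ⁰ eq) refl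
      unique σ⁰ σ⁺ eq = refute (c<tₘ +P tₘ<tₙ +P tⱼ>0 +P E⁺ σ⁰ σ⁺ eq) refl
      unique σ⁰ σ⁻ eq with ℕP.<-cmp j n
      ... | tri< j<n _ _ = refute (c<tₘ +P 3tₘ<tₙ +P tⱼ≤tₘ j<n +P tₘ>0 +P E⁺ σ⁰ σ⁻ eq) refl
      ... | tri≈ _ j≡n _ = a'≡-tₙ σ⁰ j≡n eq
      ... | tri> _ _ n<j = refute (-c<tₘ +P 3tₙ<tⱼ n<j +P tₘ<tₙ +P tₙ>0 +P E⁻ σ⁰ σ⁻ eq) refl
      unique σ⁺ σb eq with ℕP.<-cmp i n
      ... | tri≈ _ i≡n _ = a≡tₙ σb i≡n eq
      unique σ⁺ σ⁰ eq | tri< i<n _ _ = refute (c<tₘ +P 3tₘ<tₙ +P tᵢ≤tₘ i<n +P tₘ>0 +P E⁺ σ⁺ σ⁰ eq) refl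
      unique σ⁺ σ⁺ eq | tri< i<n _ _ = refute (c<tₘ +P 3tₘ<tₙ +P tᵢ≤tₘ i<n +P tₘ>0 +P tⱼ>0 +P E⁺ σ⁺ σ⁺ eq) refl
      unique σ⁺ σ⁻ eq | tri< i<n _ _ with ℕP.<-cmp j n
      ... | tri< j<n _ _ = refute (c<tₘ +P 3tₘ<tₙ +P tᵢ≤tₘ i<n +P tⱼ≤tₘ j<n +P E⁺ σ⁺ σ⁻ eq) refl
      ... | tri≈ _ j≡n _ = a'≡-tₙ σ⁺ j≡n eq
      ... | tri> _ _ n<j = refute (-c<tₘ +P 3tₙ<tⱼ n<j +P tₘ<tₙ +P tₙ>0 +P tᵢ>0 +P E⁻ σ⁺ σ⁻ eq) refl
      unique σ⁺ σ⁰ eq | tri> _ _ n<i = refute (-c<tₘ +P 3tₙ<tᵢ n<i +P tₘ<tₙ +P tₙ>0 +P E⁻ σ⁺ σ⁰ eq) refl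
      unique σ⁺ σ⁻ eq | tri> _ _ n<i = refute (-c<tₘ +P 3tₙ<tᵢ n<i +P tₘ<tₙ +P tₙ>0 +P tⱼ>0 +P E⁻ σ⁺ σ⁻ eq) refl
      unique σ⁺ σ⁺ eq | tri> _ _ n<i with ℕP.≤-<-connex i j
      ... | inj₁ i≤j = refute (c<tₘ +P tₘ<tₙ +P tᵢ≤tⱼ i≤j +P E⁺ σ⁺ σ⁺ eq) refl
      ... | inj₂ j<i = refute (scaleP 1 -c<tₘ +P 3tₙ<tᵢ n<i +P 3tⱼ<tᵢ j<i +P 3tₘ<tₙ +P tₘ>0 +P tⱼ>0
                                +P scaleN 2 (E⁻ σ⁺ σ⁺ eq)) refl
      unique σ⁻ σ⁰ eq = refute (c<tₘ +P tₘ<tₙ +P tᵢ>0 +P E⁺ σ⁻ σ⁰ eq) refl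
      unique σ⁻ σ⁺ eq = refute (c<tₘ +P tₘ<tₙ +P tᵢ>0 +P tⱼ>0 +P E⁺ σ⁻ σ⁺ eq) refl
      unique σ⁻ σ⁻ eq with ℕP.<-cmp j n
      ... | tri< j<n _ _ = refute (c<tₘ +P 3tₘ<tₙ +P tⱼ≤tₘ j<n +P tₘ>0 +P tᵢ>0 +P E⁺ σ⁻ σ⁻ eq) refl
      ... | tri≈ _ j≡n _ = a'≡-tₙ σ⁻ j≡n eq
      ... | tri> _ _ n<j with ℕP.≤-<-connex j i
      ...   | inj₁ j≤i = refute (c<tₘ +P tₘ<tₙ +P tⱼ≤tᵢ j≤i +P E⁺ σ⁻ σ⁻ eq) refl
      ...   | inj₂ i<j = refute (scaleP 1 -c<tₘ +P 3tₙ<tⱼ n<j +P 3tᵢ<tⱼ i<j +P 3tₘ<tₙ +P tₘ>0 +P tᵢ>0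
                                  +P scaleN 2 (E⁻ σ⁻ σ⁻ eq)) refl

    W-difference-unique : ∀ c m → Bounded c m → ∀ {a a'} → WSet t a → WSet t a' →
      c ≡ (t (suc m) ⊕ a') ⊕ (⊖ a) → (c ≡ a') ⊎ (c ≡ ⊖ a)
    W-difference-unique c m bd wa wa' eq with W-signed wa | W-signed wa'
    ... | σa , i , refl | σb , j , refl = W-difference.unique c m bd i j σa σb eq

    module Symmetric-difference (h : Zd d) (m : ℕ) (bd : Bounded (h ⊕ h) m) (nd : ¬ Degenerate h (suc m)) (i j : ℕ) where
      n : ℕ
      n = suc m
      b = h ⊕ (⊖ t n)
      open Certificate (h ∷ t n ∷ t i ∷ t j ∷ t m ∷ t (suc n) ∷ [])

      Eq : Sign → Sign → Set
      Eq σa σb = (⊖ b) ⊕ (⟦ σa ⟧ · t i) ≡ b ⊕ (⟦ σb ⟧ · t j)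

      Result : Sign → Set
      Result σa = (⊖ b) ⊕ (⟦ σa ⟧ · t i) ≡ 0v

      terms : Sign → Sign → List (ℤ × Fin 6)
      terms σa σb = (+ 2 , # 0) ∷ (-[1+ 1 ] , # 1) ∷ (ℤ.- ⟦ σa ⟧ , # 2) ∷ (⟦ σb ⟧ , # 3) ∷ []

      E : ∀ σa σb → Eq σa σb → Null (coefficients (terms σa σb))
      E σa σb eq = relation (terms σa σb) (symmetric-relation ⟦ σa ⟧ ⟦ σb ⟧ h (t n) (t i) (t j) eq)

      E⁺ : ∀ σa σb → Eq σa σb → NonNeg (coefficients (terms σa σb))
      E⁺ σa σb eq = E⇒N (E σa σb eq)

      E⁻ : ∀ σa σb → Eq σa σb → NonNeg (-[1+ 0 ] ⊠ coefficients (terms σa σb))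
      E⁻ σa σb eq = E⇒N (scaleE -[1+ 0 ] (E σa σb eq))

      2h<tₘ : Less (+ 2) (# 0) (# 4)
      2h<tₘ = scaled< (+ 2) (# 0) (# 4) (proj₁ (Bounded-double bd))

      -2h<tₘ : Less -[1+ 1 ] (# 0) (# 4)
      -2h<tₘ = scaled< -[1+ 1 ] (# 0) (# 4) (proj₂ (Bounded-double bd))

      3tₘ<tₙ : LessEq (+ 3) (# 4) (# 1)
      3tₘ<tₙ = P⇒N (scaled< (+ 3) (# 4) (# 1) (t-tripling m))

      3tₙ<tₙ₊₁ : LessEq (+ 3) (# 1) (# 5)
      3tₙ<tₙ₊₁ = P⇒N (scaled< (+ 3) (# 1) (# 5) (t-tripling n))

      tₘ<tₙ : LessEq (+ 1) (# 4) (# 1)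
      tₘ<tₙ = P⇒N (atom< (# 4) (# 1) (t-mono< (ℕP.n<1+n m)))

      tₘ>0 : NonNeg (basis (# 4))
      tₘ>0 = P⇒N (atom>0 (# 4) (t-positive m))

      tᵢ>0 : NonNeg (basis (# 2))
      tᵢ>0 = P⇒N (atom>0 (# 2) (t-positive i))

      tⱼ>0 : NonNeg (basis (# 3))
      tⱼ>0 = P⇒N (atom>0 (# 3) (t-positive j))

      tᵢ≤tₘ : i ℕ.< n → LessEq (+ 1) (# 2) (# 4)
      tᵢ≤tₘ p = atom≤ (# 2) (# 4) (t-mono≤ (ℕP.≤-pred p))

      tⱼ≤tₘ : j ℕ.< n → LessEq (+ 1) (# 3) (# 4)
      tⱼ≤tₘ p = atom≤ (# 3) (# 4) (t-mono≤ (ℕP.≤-pred p))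

      tᵢ≤tₙ : i ℕ.≤ n → LessEq (+ 1) (# 2) (# 1)
      tᵢ≤tₙ p = atom≤ (# 2) (# 1) (t-mono≤ p)

      tⱼ≤tₙ : j ℕ.≤ n → LessEq (+ 1) (# 3) (# 1)
      tⱼ≤tₙ p = atom≤ (# 3) (# 1) (t-mono≤ p)

      tᵢ≤tⱼ : i ℕ.≤ j → LessEq (+ 1) (# 2) (# 3)
      tᵢ≤tⱼ p = atom≤ (# 2) (# 3) (t-mono≤ p)

      tⱼ≤tᵢ : j ℕ.≤ i → LessEq (+ 1) (# 3) (# 2)
      tⱼ≤tᵢ p = atom≤ (# 3) (# 2) (t-mono≤ p)

      tₙ₊₁≤tⱼ : suc n ℕ.≤ j → LessEq (+ 1) (# 5) (# 3)
      tₙ₊₁≤tⱼ p = atom≤ (# 5) (# 3) (t-mono≤ p)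

      tₙ₊₁≤tᵢ : suc n ℕ.≤ i → LessEq (+ 1) (# 5) (# 2)
      tₙ₊₁≤tᵢ p = atom≤ (# 5) (# 2) (t-mono≤ p)

      3tₙ<tⱼ : n ℕ.< j → LessEq (+ 3) (# 1) (# 3)
      3tₙ<tⱼ p = P⇒N (scaled< (+ 3) (# 1) (# 3) (t-triple< p))

      3tₙ<tᵢ : n ℕ.< i → LessEq (+ 3) (# 1) (# 2)
      3tₙ<tᵢ p = P⇒N (scaled< (+ 3) (# 1) (# 2) (t-triple< p))

      3tⱼ<tᵢ : j ℕ.< i → LessEq (+ 3) (# 3) (# 2)
      3tⱼ<tᵢ p = P⇒N (scaled< (+ 3) (# 3) (# 2) (t-triple< p))

      3tᵢ<tⱼ : i ℕ.< j → LessEq (+ 3) (# 2) (# 3)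
      3tᵢ<tⱼ p = P⇒N (scaled< (+ 3) (# 2) (# 3) (t-triple< p))

      3tₙ₊₁<tⱼ : suc n ℕ.< j → LessEq (+ 3) (# 5) (# 3)
      3tₙ₊₁<tⱼ p = P⇒N (scaled< (+ 3) (# 5) (# 3) (t-triple< p))

      3tₙ₊₁<tᵢ : suc n ℕ.< i → LessEq (+ 3) (# 5) (# 2)
      3tₙ₊₁<tᵢ p = P⇒N (scaled< (+ 3) (# 5) (# 2) (t-triple< p))

      degenerate : ∀ σa σb → Eq σa σb → Null (coefficients ((+ 2 , # 0) ∷ (-[1+ 2 ] , # 1) ∷ (+ 1 , # 5) ∷ [])) → Result σa
      degenerate _ _ _ nul = ⊥-elim (nd (relation⁻¹ ((+ 2 , # 0) ∷ (-[1+ 2 ] , # 1) ∷ (+ 1 , # 5) ∷ []) nul))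

      a-zero : ∀ σb → Eq σ⁰ σb → Result σ⁰
      a-zero σ⁰ eq = refute (2h<tₘ +P scaleN 2 tₘ<tₙ +P tₘ>0 +P E⁺ σ⁰ σ⁰ eq) refl
      a-zero σ⁺ eq with ℕP.≤-<-connex j n
      ... | inj₁ j≤n = refute (2h<tₘ +P tⱼ≤tₙ j≤n +P tₘ<tₙ +P E⁺ σ⁰ σ⁺ eq) refl
      ... | inj₂ n<j = refute (-2h<tₘ +P 3tₙ<tⱼ n<j +P tₘ<tₙ +P E⁻ σ⁰ σ⁺ eq) refl
      a-zero σ⁻ eq = refute (2h<tₘ +P scaleN 2 tₘ<tₙ +P tₘ>0 +P tⱼ>0 +P E⁺ σ⁰ σ⁻ eq) refl

      a-positive : ∀ σb → Eq σ⁺ σb → Result σ⁺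
      a-positive σ⁰ eq = refute (2h<tₘ +P scaleN 2 tₘ<tₙ +P tₘ>0 +P tᵢ>0 +P E⁺ σ⁺ σ⁰ eq) refl
      a-positive σ⁻ eq = refute (2h<tₘ +P scaleN 2 tₘ<tₙ +P tₘ>0 +P tᵢ>0 +P tⱼ>0 +P E⁺ σ⁺ σ⁻ eq) refl
      a-positive σ⁺ eq with ℕP.≤-<-connex j n
      ... | inj₁ j≤n = refute (2h<tₘ +P tⱼ≤tₙ j≤n +P tₘ<tₙ +P tᵢ>0 +P E⁺ σ⁺ σ⁺ eq) refl
      ... | inj₂ n<j with ℕP.≤-<-connex j i
      ...   | inj₁ j≤i = refute (2h<tₘ +P tⱼ≤tᵢ j≤i +P scaleN 2 tₘ<tₙ +P tₘ>0 +P E⁺ σ⁺ σ⁺ eq) refl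
      ...   | inj₂ i<j with ℕP.m≤n⇒m<n∨m≡n n<j
      ...     | inj₁ n+1<j = refute (scaleP 2 -2h<tₘ +P 3tᵢ<tⱼ i<j +P scaleN 2 (3tₙ₊₁<tⱼ n+1<j) +P scaleN 6 3tₙ<tₙ₊₁
                                      +P scaleN 12 3tₘ<tₙ +P scaleN 33 tₘ>0 +P scaleN 3 (E⁻ σ⁺ σ⁺ eq)) refl
      ...     | inj₂ n+1≡j with ℕP.m≤n⇒m<n∨m≡n (ℕP.≤-pred (subst (i ℕ.<_) (sym n+1≡j) i<j))
      ...       | inj₁ i<n = refute (-2h<tₘ +P 3tₙ<tₙ₊₁ +P tᵢ≤tₘ i<n +P 3tₘ<tₙ +P tₘ>0
                                     +P tₙ₊₁≤tⱼ (ℕP.≤-reflexive n+1≡j) +P E⁻ σ⁺ σ⁺ eq) refl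
      ...       | inj₂ i≡n = degenerate σ⁺ σ⁺ eq
                               (E σ⁺ σ⁺ eq +E atom≡ (# 2) (# 1) (cong t i≡n) +E scaleE -[1+ 0 ] (atom≡ (# 3) (# 5) (cong t (sym n+1≡j))))

      a-negative : ∀ σb → Eq σ⁻ σb → Result σ⁻
      a-negative σ⁰ eq with ℕP.≤-<-connex i n
      ... | inj₁ i≤n = refute (2h<tₘ +P tᵢ≤tₙ i≤n +P tₘ<tₙ +P E⁺ σ⁻ σ⁰ eq) refl
      ... | inj₂ n<i = refute (-2h<tₘ +P 3tₙ<tᵢ n<i +P tₘ<tₙ +P E⁻ σ⁻ σ⁰ eq) refl
      a-negative σ⁻ eq with ℕP.≤-<-connex i n
      ... | inj₁ i≤n = refute (2h<tₘ +P tᵢ≤tₙ i≤n +P tₘ<tₙ +P tⱼ>0 +P E⁺ σ⁻ σ⁻ eq) refl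
      ... | inj₂ n<i with ℕP.≤-<-connex i j
      ...   | inj₁ i≤j = refute (2h<tₘ +P tᵢ≤tⱼ i≤j +P scaleN 2 tₘ<tₙ +P tₘ>0 +P E⁺ σ⁻ σ⁻ eq) refl
      ...   | inj₂ j<i with ℕP.m≤n⇒m<n∨m≡n n<i
      ...     | inj₁ n+1<i = refute (scaleP 2 -2h<tₘ +P 3tⱼ<tᵢ j<i +P scaleN 2 (3tₙ₊₁<tᵢ n+1<i) +P scaleN 6 3tₙ<tₙ₊₁
                                      +P scaleN 12 3tₘ<tₙ +P scaleN 33 tₘ>0 +P scaleN 3 (E⁻ σ⁻ σ⁻ eq)) refl
      ...     | inj₂ n+1≡i with ℕP.m≤n⇒m<n∨m≡n (ℕP.≤-pred (subst (j ℕ.<_) (sym n+1≡i) j<i))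
      ...       | inj₁ j<n = refute (-2h<tₘ +P 3tₙ<tₙ₊₁ +P tⱼ≤tₘ j<n +P 3tₘ<tₙ +P tₘ>0
                                     +P tₙ₊₁≤tᵢ (ℕP.≤-reflexive n+1≡i) +P E⁻ σ⁻ σ⁻ eq) refl
      ...       | inj₂ j≡n = degenerate σ⁻ σ⁻ eq
                               (E σ⁻ σ⁻ eq +E scaleE -[1+ 0 ] (atom≡ (# 2) (# 5) (cong t (sym n+1≡i))) +E atom≡ (# 3) (# 1) (cong t j≡n))
      a-negative σ⁺ eq with ℕP.<-cmp i n
      ... | tri> _ _ n<i = refute (-2h<tₘ +P 3tₙ<tᵢ n<i +P tₘ<tₙ +P tⱼ>0 +P E⁻ σ⁻ σ⁺ eq) refl
      ... | tri< i<n _ _ with ℕP.≤-<-connex j n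
      ...   | inj₁ j≤n = refute (2h<tₘ +P tᵢ≤tₘ i<n +P tⱼ≤tₙ j≤n +P 3tₘ<tₙ +P tₘ>0 +P E⁺ σ⁻ σ⁺ eq) refl
      ...   | inj₂ n<j = refute (-2h<tₘ +P 3tₙ<tⱼ n<j +P tₘ<tₙ +P tᵢ>0 +P E⁻ σ⁻ σ⁺ eq) refl
      a-negative σ⁺ eq | tri≈ _ i≡n _ with ℕP.<-cmp j n
      ...   | tri< j<n _ _ = refute (2h<tₘ +P tⱼ≤tₘ j<n +P 3tₘ<tₙ +P tₘ>0 +P tᵢ≤tₙ (ℕP.≤-reflexive i≡n) +P E⁺ σ⁻ σ⁺ eq) refl
      ...   | tri> _ _ n<j = refute (-2h<tₘ +P 3tₙ<tⱼ n<j +P tₘ<tₙ +P tᵢ>0 +P E⁻ σ⁻ σ⁺ eq) refl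
      ...   | tri≈ _ j≡n _ =
        subst (λ k → (⊖ b) ⊕ (-[1+ 0 ] · t k) ≡ 0v) (sym i≡n)
          (symmetric-relation-at-zero h (t n) (subst₂ (λ k l → (⊖ b) ⊕ (-[1+ 0 ] · t k) ≡ b ⊕ ((+ 1) · t l)) i≡n j≡n eq))

      unique : ∀ σa σb → Eq σa σb → Result σa
      unique σ⁰ = a-zero
      unique σ⁺ = a-positive
      unique σ⁻ = a-negative

    W-symmetric-difference : ∀ h m → Bounded (h ⊕ h) m → ¬ Degenerate h (suc m) → ∀ {a a'} → WSet t a → WSet t a' →
      (⊖ (h ⊕ (⊖ t (suc m)))) ⊕ a ≡ (h ⊕ (⊖ t (suc m))) ⊕ a' → (⊖ (h ⊕ (⊖ t (suc m)))) ⊕ a ≡ 0v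
    W-symmetric-difference h m bd nd wa wa' eq with W-signed wa | W-signed wa'
    ... | σa , i , refl | σb , j , refl = Symmetric-difference.unique h m bd nd i j σa σb eq

module Cofinality {d : ℕ} (t : ℕ → Zd (suc d))
  (t-increasing : ∀ n → t n <ₗ t (suc n))
  (t₀-positive : 0v <ₗ t 0)
  (t-doubling : ∀ n → ((+ 2) · t n) ≤ₗ t (suc n)) where

  open LacunarySequence t t-increasing t₀-positive t-doubling using (t-mono≤)

  first : Zd (suc d) → ℤ
  first x = lookup x Fin.zero

  first-mono-≤ₗ : ∀ {x y : Zd (suc d)} → x ≤ₗ y → first x ℤ.≤ first y
  first-mono-≤ₗ {a ∷ x} {b ∷ y} (inj₁ (inj₁ a<b)) = ℤP.<⇒≤ a<b
  first-mono-≤ₗ {a ∷ x} {b ∷ y} (inj₁ (inj₂ (a≡b , _))) = ℤP.≤-reflexive a≡b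
  first-mono-≤ₗ (inj₂ refl) = ℤP.≤-refl

  first-· : ∀ (c : ℤ) (x : Zd (suc d)) → first (c · x) ≡ c ℤ.* first x
  first-· c (a ∷ x) = refl

  first-grows : ∀ N → + 1 ℤ.≤ first (t N) → ∀ k → + suc k ℤ.≤ first (t (N + k))
  first-grows N h₀ zero = subst (λ w → + 1 ℤ.≤ first (t w)) (sym (ℕP.+-identityʳ N)) h₀
  first-grows N h₀ (suc k) = subst (λ w → + suc (suc k) ℤ.≤ first (t w)) (sym (ℕP.+-suc N k)) step
    where
    h : ℤ
    h = first (t (N + k))
    ih : + suc k ℤ.≤ h
    ih = first-grows N h₀ k
    step : + suc (suc k) ℤ.≤ first (t (suc (N + k)))
    step = begin
      + suc (suc k)      ≡⟨ cong +_ (ℕP.+-comm 1 (suc k)) ⟩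
      + suc k ℤ.+ + 1    ≤⟨ ℤP.+-mono-≤ ih (ℤP.≤-trans (ℤ.+≤+ (ℕ.s≤s ℕ.z≤n)) ih) ⟩
      h ℤ.+ h            ≡⟨ cong (λ w → h ℤ.+ w) (sym (ℤP.*-identityˡ h)) ⟩
      h ℤ.+ + 1 ℤ.* h    ≡⟨ sym (ℤP.suc-* (+ 1) h) ⟩
      + 2 ℤ.* h          ≡⟨ sym (first-· (+ 2) (t (N + k))) ⟩
      first ((+ 2) · t (N + k)) ≤⟨ first-mono-≤ₗ (t-doubling (N + k)) ⟩
      first (t (suc (N + k))) ∎
      where open ℤP.≤-Reasoning

  -- Of the hypothesis that some t_n has only positive coordinates, just the first one is needed.
  cofinal : (∃ λ n → + 0 < first (t n)) → ∀ x → Eventually (λ m → x <ₗ t m)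
  cofinal (N , +0<tN) (a ∷ x) = K , λ m K≤m → <ₗ-≤ₗ-trans a∷x<tK (t-mono≤ K≤m)
    where
    K : ℕ
    K = N + ℤ.∣ a ∣
    a<1+∣a∣ : ∀ a → a ℤ.< + suc ℤ.∣ a ∣
    a<1+∣a∣ (+ n) = ℤ.+<+ (ℕP.n<1+n n)
    a<1+∣a∣ -[1+ n ] = ℤ.-<+
    a∷x<tK : (a ∷ x) <ₗ t K
    a∷x<tK with t K | first-grows N (ℤP.i<j⇒suc[i]≤j +0<tN) ℤ.∣ a ∣
    ... | b ∷ y | 1+∣a∣≤b = inj₁ (ℤP.<-≤-trans (a<1+∣a∣ a) 1+∣a∣≤b)

module Constructions {d : ℕ} (t : ℕ → Zd d)
  (t-increasing : ∀ n → t n <ₗ t (suc n))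
  (t₀-positive : 0v <ₗ t 0)
  (t-doubling : ∀ n → ((+ 2) · t n) ≤ₗ t (suc n))
  (t-cofinal : ∀ x → Eventually (λ m → x <ₗ t m)) where

  open LacunarySequence t t-increasing t₀-positive t-doubling

  eventually-bounded : ∀ x → Eventually (Bounded x)
  eventually-bounded x = eventually-× (t-cofinal x) (t-cofinal (⊖ x))

  T? : ∀ x → Dec (TSet t x)
  T? x with t-cofinal x
  ... | K , x<t with FinP.any? {n = K} (λ i → t (toℕ i) ≟ᵥ x)
  ...   | yes (i , e) = yes (toℕ i , e)
  ...   | no none = no x∉T
    where
    x∉T : ¬ TSet t x
    x∉T (n , e) with n ℕP.<? K
    ... | yes n<K = none (fromℕ< n<K , subst (λ w → t w ≡ x) (sym (FinP.toℕ-fromℕ< n<K)) e)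
    ... | no n≮K = <ₗ-irrefl (subst (x <ₗ_) e (x<t n (ℕP.≮⇒≥ n≮K)))

  W? : ∀ x → Dec (WSet t x)
  W? x = T? x ⊎-dec ((x ≟ᵥ 0v) ⊎-dec T? (⊖ x))

  V? : ∀ x → Dec (VSet t x)
  V? x = T? x ⊎-dec T? (⊖ x)

  t₀≢t₁ : t 0 ≢ t 1
  t₀≢t₁ e = <ₗ-irrefl (subst (_<ₗ t 1) e (t-increasing 0))

  W-symmetric : ∀ {x} → WSet t x → WSet t (⊖ x)
  W-symmetric {x} (inj₁ (i , e)) = inj₂ (inj₂ (i , trans e (sym (⊖-involutive x))))
  W-symmetric (inj₂ (inj₁ refl)) = inj₂ (inj₁ ⊖-0v)
  W-symmetric (inj₂ (inj₂ x∈-T)) = inj₁ x∈-T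

  V-symmetric : ∀ {x} → VSet t x → VSet t (⊖ x)
  V-symmetric {x} (inj₁ (i , e)) = inj₂ (i , trans e (sym (⊖-involutive x)))
  V-symmetric (inj₂ x∈-T) = inj₁ x∈-T

  V⊆W : ∀ {x} → VSet t x → WSet t x
  V⊆W (inj₁ x∈T) = inj₁ x∈T
  V⊆W (inj₂ x∈-T) = inj₂ (inj₂ x∈-T)

  0∉T : ¬ TSet t 0v
  0∉T (i , e) = <ₗ-irrefl (subst (0v <ₗ_) e (t-positive i))

  0∉V : ¬ VSet t 0v
  0∉V (inj₁ 0∈T) = 0∉T 0∈T
  0∉V (inj₂ (i , e)) = 0∉T (i , trans e ⊖-0v)

  Separated : Subset d → Zd d → ℕ → Set
  Separated A c m = ∀ {a a'} → A a → A a' → c ≢ (t (suc m) ⊕ a') ⊕ (⊖ a)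

  eventually-no-gap : ∀ i → CoordGapToInfinity t i → ∀ c → Eventually (λ m → ¬ Gap c (suc m))
  eventually-no-gap i gap-grows c with gap-grows (lookup (⊖ c) i)
  ... | N , beyond = N , λ m N≤m gap → ℤP.<-irrefl refl
    (subst (λ w → lookup (⊖ c) i ℤ.< lookup w i) (gap-relation⇒gap c (t (suc m)) (t (suc (suc m))) gap)
      (beyond (suc m) (ℕP.m≤n⇒m≤1+n N≤m)))

  T-separation : ∀ i → CoordGapToInfinity t i → ∀ c → ¬ TSet t c → Eventually (Separated (TSet t) c)
  T-separation i gap-grows c c∉T with eventually-× (eventually-bounded c) (eventually-no-gap i gap-grows c)
  ... | K , f = K , λ m K≤m a∈T a'∈T e →
    c∉T (subst (TSet t) (sym (T-difference-unique c m (proj₁ (f m K≤m)) (proj₂ (f m K≤m)) a∈T a'∈T e)) a'∈T)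

  T-complement : Subset d
  T-complement x = (x <ₗ 0v) × ¬ (∃ λ a → ∃ λ c → a ≢ c × x ≡ ⊖ (t a ⊕ t c))

  T-complement-covered : Covers T-complement (TSet t)
  T-complement-covered g with T? (⊖ g)
  ... | yes (b , tb≡⊖g) = ⊖ (t b ⊕ t b) , t b , (negative , not-pair-sum) , (b , refl) ,
                          trans (⊖[x⊕x]⊕x≡⊖x (t b)) (trans (cong ⊖_ tb≡⊖g) (⊖-involutive g))
    where
    negative : (⊖ (t b ⊕ t b)) <ₗ 0v
    negative = subst₂ _<ₗ_ (⊕-identityˡ _) (⊕-inverseʳ _)
                 (⊕-monoˡ-<ₗ (⊖ (t b ⊕ t b)) (positive-⊕ (t-positive b) (inj₁ (t-positive b))))
    not-pair-sum : ¬ (∃ λ a → ∃ λ c → a ≢ c × ⊖ (t b ⊕ t b) ≡ ⊖ (t a ⊕ t c))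
    not-pair-sum (a , c , a≢c , e) = double-not-sum-of-distinct b a c a≢c e
  ... | no ⊖g∉T with eventually-× (eventually-bounded g) (eventually-bounded (g ⊕ g))
  ... | K , f = g ⊕ (⊖ t (suc K)) , t (suc K) , (negative , not-pair-sum) , (suc K , refl) , x⊖y⊕y≡x g (t (suc K))
    where
    bounds : Bounded g K × Bounded (g ⊕ g) K
    bounds = f K ℕP.≤-refl
    negative : (g ⊕ (⊖ t (suc K))) <ₗ 0v
    negative = x<y⇒x⊖y<0 (<ₗ-trans (proj₁ (proj₁ bounds)) (t-increasing K))
    not-pair-sum : ¬ (∃ λ a → ∃ λ c → a ≢ c × g ⊕ (⊖ t (suc K)) ≡ ⊖ (t a ⊕ t c))
    not-pair-sum (a , c , a≢c , e) = shifted-not-minus-sum-of-distinct g K (proj₂ bounds) ⊖g∉T a c a≢c e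

  -- -t_m has no other representation s + t_n
  T-complement-minimal : ∀ w → TSet t w → ¬ Covers T-complement (λ x → TSet t x × x ≢ w)
  T-complement-minimal w (m , tm≡w) cover with cover (⊖ t m)
  ... | s , x , (_ , not-pair-sum) , ((n , tn≡x) , x≢w) , e =
    not-pair-sum (m , n , m≢n , s⊕y≡⊖x⇒s≡⊖[x⊕y] s (t m) (t n) (trans (cong (s ⊕_) tn≡x) e))
    where
    m≢n : m ≢ n
    m≢n m≡n = x≢w (trans (sym tn≡x) (trans (cong t (sym m≡n)) tm≡w))

  T-minimal-complement : Σ (Subset d) λ S → OutsideNonneg S × Nonempty S × MinimalComplement (TSet t) S
  T-minimal-complement =
    T-complement , (λ x x∈S → <ₗ⇒≱ₗ (proj₁ x∈S)) , nonempty , (t 0 , 0 , refl) , T-complement-covered , T-complement-minimal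
    where
    nonempty : Nonempty T-complement
    nonempty with T-complement-covered 0v
    ... | s , _ , s∈S , _ = s , s∈S

  -- Each uncovered g is covered by b = g - t_K with K large: b is negative, and b ⊕ A
  -- meets y ⊕ A (y already chosen) only if g - y is a forbidden difference.
  module NegativeComplement (A : Subset d) (A? : ∀ x → Dec (A x)) (t∈A : ∀ n → A (t n))
    (separation : ∀ c → ¬ A c → Eventually (Separated A c)) where

    Invariant : List (Zd d) → Set
    Invariant L = (∀ {b} → b ∈ L → b <ₗ 0v) × Unambiguous A (λ b → b ∈ L)

    extend : ∀ L → Invariant L → ∀ g → ¬ CoveredBy A L g → ∃ λ N → Invariant (N ++ L) × CoveredBy A (N ++ L) g
    extend L (negative , unamb) g uncovered
      with eventually-× (eventually-bounded g)
                        (eventually-∀∈ L (λ {y} y∈L → separation (g ⊕ (⊖ y)) (λ a → uncovered (lose y∈L a))))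
    ... | K , f = b ∷ [] , (negative' , unamb') , here (subst A (sym (g⊖[g⊖x]≡x g (t (suc K)))) (t∈A (suc K)))
      where
      b = g ⊕ (⊖ t (suc K))
      requirements : Bounded g K × (∀ {y} → y ∈ L → Separated A (g ⊕ (⊖ y)) K)
      requirements = f K ℕP.≤-refl

      separate : ∀ {y a a'} → y ∈ L → A a → A a' → b ⊕ a ≢ y ⊕ a'
      separate y∈L a∈A a'∈A e = proj₂ requirements y∈L a∈A a'∈A (shift-equation g (t (suc K)) _ _ _ e)

      negative' : ∀ {x} → x ∈ b ∷ L → x <ₗ 0v
      negative' (here refl) = x<y⇒x⊖y<0 (<ₗ-trans (proj₁ (proj₁ requirements)) (t-increasing K))
      negative' (there x∈L) = negative x∈L

      unamb' : Unambiguous A (λ x → x ∈ b ∷ L)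
      unamb' (here refl) (here refl) _ _ _ = inj₁ refl
      unamb' (here refl) (there y∈L) a∈A a'∈A e = ⊥-elim (separate y∈L a∈A a'∈A e)
      unamb' (there y∈L) (here refl) a∈A a'∈A e = ⊥-elim (separate y∈L a'∈A a∈A (sym e))
      unamb' (there y∈L) (there y'∈L) a∈A a'∈A e = unamb y∈L y'∈L a∈A a'∈A e

    open GreedyUnion A A? Invariant [] ((λ ()) , (λ ())) extend public

    Union-negative : OutsideNonneg Union
    Union-negative x (k , x∈) = <ₗ⇒≱ₗ (proj₁ (proj₂ (stage k)) x∈)

    Union-co-minimal : ∀ y → ¬ A y → CoMinimalPair A Union
    Union-co-minimal y y∉A =
      co-minimal-criterion A Union Union-covers (Union-unambiguous proj₂) (t∈A 0) (t∈A 1) t₀≢t₁ y y∉A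

  module Tripling (t-tripling : ∀ n → ((+ 3) · t n) <ₗ t (suc n)) where
    open Sparse t-tripling

    2t₀∉W : ¬ WSet t (t 0 ⊕ t 0)
    2t₀∉W (inj₁ (zero , e)) = refute (atom>0 (# 0) t₀-positive +P E⇒N E) refl
      where
      open Certificate (t 0 ∷ [])
      E : Null (basis (# 0) ⊞ -[1+ 1 ] ⊠ basis (# 0))
      E = scaled≡ (+ 2) (# 0) (# 0) (trans e (sym (2·≡⊕ (t 0))))
    2t₀∉W (inj₁ (suc i , e)) = refute (scaled< (+ 3) (# 0) (# 1) (t-triple< (ℕ.s≤s ℕ.z≤n)) +P E⇒N (scaleE -[1+ 0 ] E)
                                       +P P⇒N (atom>0 (# 0) t₀-positive)) refl
      where
      open Certificate (t 0 ∷ t (suc i) ∷ [])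
      E : Null (basis (# 1) ⊞ -[1+ 1 ] ⊠ basis (# 0))
      E = scaled≡ (+ 2) (# 0) (# 1) (trans e (sym (2·≡⊕ (t 0))))
    2t₀∉W (inj₂ (inj₁ e)) = <ₗ-irrefl (subst (0v <ₗ_) e (positive-⊕ t₀-positive (inj₁ t₀-positive)))
    2t₀∉W (inj₂ (inj₂ (i , e))) = refute (atom>0 (# 1) (t-positive i) +P scaleN 2 (P⇒N (atom>0 (# 0) t₀-positive))
                                          +P E⇒N (scaleE -[1+ 0 ] E)) refl
      where
      open Certificate (t 0 ∷ t i ∷ [])
      E : Null (basis (# 1) ⊞ + 2 ⊠ basis (# 0))
      E = scaled≡ -[1+ 1 ] (# 0) (# 1) (trans e (sym (trans (-·≡⊖· (+ 2) (t 0)) (cong ⊖_ (2·≡⊕ (t 0))))))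

    separated : ∀ {A : Subset d} → (∀ {x} → A x → WSet t x) → (∀ {x} → A x → A (⊖ x)) →
      ∀ c m → Bounded c m → ¬ A c → Separated A c m
    separated {A} A⊆W A-symmetric c m bd c∉A a∈A a'∈A e with W-difference-unique c m bd (A⊆W a∈A) (A⊆W a'∈A) e
    ... | inj₁ c≡a' = c∉A (subst A (sym c≡a') a'∈A)
    ... | inj₂ c≡⊖a = c∉A (subst A (sym c≡⊖a) (A-symmetric a∈A))

    not-both-degenerate : ∀ g n → Degenerate g n → ¬ Degenerate (⊖ g) n
    not-both-degenerate g n g-deg ⊖g-deg =
      refute (scaleP 1 (scaled< (+ 3) (# 2) (# 3) (t-tripling n)) +P E⇒N (scaleE -[1+ 0 ] (relation (terms (# 0)) g-deg))
              +P E⇒N (scaleE -[1+ 0 ] (relation (terms (# 1)) ⊖g-deg))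
              +P E⇒N (scaleE (+ 2) (scaled≡ -[1+ 0 ] (# 0) (# 1) (sym (-1·≡⊖ g))))) refl
      where
      open Certificate (g ∷ (⊖ g) ∷ t n ∷ t (suc n) ∷ [])
      terms : Fin 4 → List (ℤ × Fin 4)
      terms h = (+ 2 , h) ∷ (-[1+ 2 ] , # 2) ∷ (+ 1 , # 3) ∷ []

    -- Each uncovered g is covered through ±b with b = h - t_{K+1}, h = ±g chosen so
    -- that b ⊕ A and (⊖ b) ⊕ A meet only in 0v.
    module SymmetricComplement (A : Subset d) (A? : ∀ x → Dec (A x)) (A⊆W : ∀ {x} → A x → WSet t x)
      (A-symmetric : ∀ {x} → A x → A (⊖ x)) (t∈A : ∀ n → A (t n))
      (L₀ : List (Zd d)) (L₀-symmetric : ∀ {b} → b ∈ L₀ → (⊖ b) ∈ L₀)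
      (L₀-unambiguous : Unambiguous A (λ b → b ∈ L₀)) where

      Invariant : List (Zd d) → Set
      Invariant L = (0v ∈ L → 0v ∈ L₀) × (∀ {b} → b ∈ L → (⊖ b) ∈ L) × Unambiguous A (λ b → b ∈ L)

      Requirements : List (Zd d) → Zd d → ℕ → Set
      Requirements L h m = Bounded h m × Bounded (h ⊕ h) m × (∀ {b} → b ∈ L → Bounded (h ⊕ (⊖ b)) m)

      eventually-requirements : ∀ L h → Eventually (Requirements L h)
      eventually-requirements L h = eventually-× (eventually-bounded h)
        (eventually-× (eventually-bounded (h ⊕ h)) (eventually-∀∈ L (λ {b} _ → eventually-bounded (h ⊕ (⊖ b)))))

      module Extension (L : List (Zd d)) (inv : Invariant L) (h : Zd d) (m : ℕ) (req : Requirements L h m)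
        (nd : ¬ Degenerate h (suc m)) (uncovered : ∀ {b} → b ∈ L → ¬ A (h ⊕ (⊖ b))) where

        b : Zd d
        b = h ⊕ (⊖ t (suc m))

        b≢0 : b ≢ 0v
        b≢0 e = <ₗ-irrefl (subst (_<ₗ t (suc m)) (x⊖y≡0⇒x≡y h (t (suc m)) e) (<ₗ-trans (proj₁ (proj₁ req)) (t-increasing m)))

        separate : ∀ {y a a'} → y ∈ L → A a → A a' → b ⊕ a ≢ y ⊕ a'
        separate {y} y∈L a∈A a'∈A e =
          separated A⊆W A-symmetric (h ⊕ (⊖ y)) m (proj₂ (proj₂ req) y∈L) (uncovered y∈L) a∈A a'∈A
            (shift-equation h (t (suc m)) y _ _ e)

        separate⁻ : ∀ {y a a'} → y ∈ L → A a → A a' → (⊖ b) ⊕ a ≢ y ⊕ a'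
        separate⁻ {y} {a} {a'} y∈L a∈A a'∈A e =
          separate (proj₁ (proj₂ inv) y∈L) (A-symmetric a∈A) (A-symmetric a'∈A) (⊖-equation b a y a' e)

        self : ∀ {a a'} → A a → A a' → (⊖ b) ⊕ a ≡ b ⊕ a' → (⊖ b) ⊕ a ≡ 0v
        self a∈A a'∈A = W-symmetric-difference h m (proj₁ (proj₂ req)) nd (A⊆W a∈A) (A⊆W a'∈A)

        invariant : Invariant (b ∷ (⊖ b) ∷ L)
        invariant = zero-old , symmetric , unamb
          where
          zero-old : 0v ∈ b ∷ (⊖ b) ∷ L → 0v ∈ L₀
          zero-old (here 0≡b) = ⊥-elim (b≢0 (sym 0≡b))
          zero-old (there (here 0≡⊖b)) = ⊥-elim (b≢0 (trans (sym (⊖-involutive b)) (trans (cong ⊖_ (sym 0≡⊖b)) ⊖-0v)))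
          zero-old (there (there 0∈L)) = proj₁ inv 0∈L
          symmetric : ∀ {x} → x ∈ b ∷ (⊖ b) ∷ L → (⊖ x) ∈ b ∷ (⊖ b) ∷ L
          symmetric (here refl) = there (here refl)
          symmetric (there (here refl)) = here (⊖-involutive b)
          symmetric (there (there x∈L)) = there (there (proj₁ (proj₂ inv) x∈L))
          unamb : Unambiguous A (λ x → x ∈ b ∷ (⊖ b) ∷ L)
          unamb (here refl) (here refl) _ _ _ = inj₁ refl
          unamb (here refl) (there (here refl)) a∈A a'∈A e = inj₂ (trans e (self a'∈A a∈A (sym e)))
          unamb (here refl) (there (there y∈L)) a∈A a'∈A e = ⊥-elim (separate y∈L a∈A a'∈A e)
          unamb (there (here refl)) (here refl) a∈A a'∈A e = inj₂ (self a∈A a'∈A e)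
          unamb (there (here refl)) (there (here refl)) _ _ _ = inj₁ refl
          unamb (there (here refl)) (there (there y∈L)) a∈A a'∈A e = ⊥-elim (separate⁻ y∈L a∈A a'∈A e)
          unamb (there (there y∈L)) (here refl) a∈A a'∈A e = ⊥-elim (separate y∈L a'∈A a∈A (sym e))
          unamb (there (there y∈L)) (there (here refl)) a∈A a'∈A e = ⊥-elim (separate⁻ y∈L a'∈A a∈A (sym e))
          unamb (there (there y∈L)) (there (there y'∈L)) a∈A a'∈A e = proj₂ (proj₂ inv) y∈L y'∈L a∈A a'∈A e

      extend : ∀ L → Invariant L → ∀ g → ¬ CoveredBy A L g → ∃ λ N → Invariant (N ++ L) × CoveredBy A (N ++ L) g
      extend L inv g uncovered with eventually-× (eventually-requirements L g) (eventually-requirements L (⊖ g))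
      ... | K , f with Degenerate? g (suc K)
      ...   | no g-nondegenerate = b ∷ (⊖ b) ∷ [] , invariant , here (subst A (sym (g⊖[g⊖x]≡x g (t (suc K)))) (t∈A (suc K)))
        where
        open Extension L inv g K (proj₁ (f K ℕP.≤-refl)) g-nondegenerate (λ y∈L a → uncovered (lose y∈L a))
      ...   | yes g-degenerate =
        b ∷ (⊖ b) ∷ [] , invariant , there (here (subst A (sym (g⊕[⊖g⊖x]≡⊖x g (t (suc K)))) (A-symmetric (t∈A (suc K)))))
        where
        ⊖g-uncovered : ∀ {y} → y ∈ L → ¬ A ((⊖ g) ⊕ (⊖ y))
        ⊖g-uncovered {y} y∈L a = uncovered (lose (proj₁ (proj₂ inv) y∈L) (subst A (⊖[⊖g⊖b]≡g⊖⊖b g y) (A-symmetric a)))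
        open Extension L inv (⊖ g) K (proj₂ (f K ℕP.≤-refl)) (not-both-degenerate g (suc K) g-degenerate) ⊖g-uncovered

      open GreedyUnion A A? Invariant L₀ ((λ 0∈L₀ → 0∈L₀) , L₀-symmetric , L₀-unambiguous) extend public

      Union-symmetric : Symmetric Union
      Union-symmetric x = (λ { (k , x∈) → k , proj₁ (proj₂ (proj₂ (stage k))) x∈ })
                        , (λ { (k , ⊖x∈) → k , subst (_∈ proj₁ (stage k)) (⊖-involutive x) (proj₁ (proj₂ (proj₂ (stage k))) ⊖x∈) })

      Union-0 : Union 0v → 0v ∈ L₀
      Union-0 (k , 0∈) = proj₁ (proj₂ (stage k)) 0∈

      Union-co-minimal : ∀ y → ¬ A y → CoMinimalPair A Union
      Union-co-minimal y y∉A =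
        co-minimal-criterion A Union Union-covers (Union-unambiguous (λ inv → proj₂ (proj₂ inv))) (t∈A 0) (t∈A 1) t₀≢t₁ y y∉A

    W-like-separation : ∀ {A : Subset d} → (∀ {x} → A x → WSet t x) → (∀ {x} → A x → A (⊖ x)) →
      ∀ c → ¬ A c → Eventually (Separated A c)
    W-like-separation A⊆W A-symmetric c c∉A with eventually-bounded c
    ... | K , bounded = K , λ m K≤m → separated A⊆W A-symmetric c m (bounded m K≤m) c∉A

    t∈W : ∀ n → WSet t (t n)
    t∈W n = inj₁ (n , refl)

    t∈V : ∀ n → VSet t (t n)
    t∈V n = inj₁ (n , refl)

    [0]-symmetric : ∀ {b : Zd d} → b ∈ 0v ∷ [] → (⊖ b) ∈ 0v ∷ []
    [0]-symmetric (here refl) = here ⊖-0v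

    [0]-unambiguous : ∀ {A : Subset d} → Unambiguous A (λ b → b ∈ 0v ∷ [])
    [0]-unambiguous (here refl) (here refl) _ _ _ = inj₁ refl

    W-pair-symmetric-∋0 : Σ (Subset d) λ E → Symmetric E × E 0v × CoMinimalPair (WSet t) E
    W-pair-symmetric-∋0 = Union , Union-symmetric , (0 , here refl) , Union-co-minimal (t 0 ⊕ t 0) 2t₀∉W
      where open SymmetricComplement (WSet t) W? (λ x∈W → x∈W) W-symmetric t∈W (0v ∷ []) [0]-symmetric ([0]-unambiguous {WSet t})

    W-pair-symmetric-∌0 : Σ (Subset d) λ F → Symmetric F × ¬ F 0v × CoMinimalPair (WSet t) F
    W-pair-symmetric-∌0 = Union , Union-symmetric , (λ 0∈F → case Union-0 0∈F of λ ()) , Union-co-minimal (t 0 ⊕ t 0) 2t₀∉W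
      where open SymmetricComplement (WSet t) W? (λ x∈W → x∈W) W-symmetric t∈W [] (λ ()) (λ ())

    W-pair-negative : Σ (Subset d) λ G → OutsideNonneg G × CoMinimalPair (WSet t) G
    W-pair-negative = Union , Union-negative , Union-co-minimal (t 0 ⊕ t 0) 2t₀∉W
      where open NegativeComplement (WSet t) W? t∈W (W-like-separation (λ x∈W → x∈W) W-symmetric)

    V-pair-symmetric-∋0 : Σ (Subset d) λ P → Symmetric P × P 0v × CoMinimalPair (VSet t) P
    V-pair-symmetric-∋0 = Union , Union-symmetric , (0 , here refl) , Union-co-minimal 0v 0∉V
      where open SymmetricComplement (VSet t) V? V⊆W V-symmetric t∈V (0v ∷ []) [0]-symmetric ([0]-unambiguous {VSet t})

    V-pair-symmetric-∌0 : Σ (Subset d) λ Q → Symmetric Q × ¬ Q 0v × CoMinimalPair (VSet t) Q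
    V-pair-symmetric-∌0 = Union , Union-symmetric , (λ 0∈Q → case Union-0 0∈Q of λ ()) , Union-co-minimal 0v 0∉V
      where open SymmetricComplement (VSet t) V? V⊆W V-symmetric t∈V [] (λ ()) (λ ())

    V-pair-negative : Σ (Subset d) λ R → OutsideNonneg R × CoMinimalPair (VSet t) R
    V-pair-negative = Union , Union-negative , Union-co-minimal 0v 0∉V
      where open NegativeComplement (VSet t) V? t∈V (W-like-separation V⊆W V-symmetric)

  T-pair-negative : ∀ i → CoordGapToInfinity t i → Σ (Subset d) λ S → OutsideNonneg S × CoMinimalPair (TSet t) S
  T-pair-negative i gap-grows = Union , Union-negative , Union-co-minimal 0v 0∉T
    where open NegativeComplement (TSet t) T? (λ n → n , refl) (T-separation i gap-grows)

theorem2p1 : (d : ℕ) → d ≥ 1 → (t : ℕ → Zd d) →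
    (∀ n → t n <ₗ t (suc n)) →
    0v <ₗ t 0 →
    (∀ n → ((+ 2) · t n) ≤ₗ t (suc n)) →
    (∃ λ n → ∀ (i : Fin d) → + 0 < lookup (t n) i) →
    ((∀ n → ((+ 3) · t n) <ₗ t (suc n)) →
      Σ (Subset d) λ E → Symmetric E × E 0v × CoMinimalPair (WSet t) E)
    × ((∀ n → ((+ 3) · t n) <ₗ t (suc n)) →
      Σ (Subset d) λ F → Symmetric F × ¬ F 0v × CoMinimalPair (WSet t) F)
    × ((∀ n → ((+ 6) · t n) ≤ₗ t (suc n)) →
      Σ (Subset d) λ G → OutsideNonneg G × CoMinimalPair (WSet t) G)
    × ((∀ n → ((+ 3) · t n) <ₗ t (suc n)) →
      Σ (Subset d) λ P → Symmetric P × P 0v × CoMinimalPair (VSet t) P)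
    × ((∀ n → ((+ 3) · t n) <ₗ t (suc n)) →
      Σ (Subset d) λ Q → Symmetric Q × ¬ Q 0v × CoMinimalPair (VSet t) Q)
    × ((∀ n → ((+ 6) · t n) ≤ₗ t (suc n)) →
      Σ (Subset d) λ R → OutsideNonneg R × CoMinimalPair (VSet t) R)
    × ((∀ n → ((+ 2) · t n) ≤ₗ t (suc n)) →
      (Σ (Subset d) λ S → OutsideNonneg S × Nonempty S × MinimalComplement (TSet t) S)
      × ((∃ λ (i : Fin d) → CoordGapToInfinity t i) →
        Σ (Subset d) λ S → OutsideNonneg S × CoMinimalPair (TSet t) S))
theorem2p1 (suc d) _ t t-increasing t₀-positive t-doubling (n , tₙ-positive) =
  Tripling.W-pair-symmetric-∋0 , Tripling.W-pair-symmetric-∌0 , Tripling.W-pair-negative ∘ sextupling⇒tripling ,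
  Tripling.V-pair-symmetric-∋0 , Tripling.V-pair-symmetric-∌0 , Tripling.V-pair-negative ∘ sextupling⇒tripling ,
  λ _ → T-minimal-complement , λ (i , gap-grows) → T-pair-negative i gap-grows
  where
  t-cofinal : ∀ x → Eventually (λ m → x <ₗ t m)
  t-cofinal = Cofinality.cofinal t t-increasing t₀-positive t-doubling (n , tₙ-positive Fin.zero)
  open LacunarySequence t t-increasing t₀-positive t-doubling using (sextupling⇒tripling)
  open Constructions t t-increasing t₀-positive t-doubling t-cofinal
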